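{- There exists a sequence of real numbers $\gamma(2),\gamma(3),\dots$ with $\gamma(k)\to 0$ exponentially fast as $k\to\infty$ such that for every $k\ge 2$ and every $k$-uniform cross intersecting matching $\mathcal{A}_1,\dots,\mathcal{A}_t$ of type $(d_1,\dots,d_t)$, $$\sum_{i=1}^t d_i(d_i-1) \leq (1+\gamma(k))\binom{2k}{k}.$$
   Context: A sequence of finite hypergraphs (families of sets) $\mathcal{A}_1,\dots,\mathcal{A}_t$ is a $k$-uniform cross intersecting matching of size $t$ and type $(d_1,\dots,d_t)$ if $t,k\geq 2$, $d_i\geq 2$ for all $i$, each $\mathcal{A}_i$ consists of $d_i$ pairwise disjoint $k$-element sets, and $X\cap Y\neq\emptyset$ whenever $X\in\mathcal{A}_i$, $Y\in\mathcal{A}_j$ with $i\neq j$. -}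

module Defs where

open import Data.Nat using (ℕ; zero; suc; _*_; _∸_; _≤_)
open import Data.Nat.Combinatorics using (_C_)
open import Data.Fin using (Fin)
open import Data.Fin.Subset using (Subset; ∣_∣; _∩_; Empty; Nonempty)
open import Data.List using (map; allFin)
open import Data.Nat.ListAction using (sum)
open import Data.Product using (_×_)
open import Data.Integer using (+_)
import Data.Rational as ℚ
open ℚ using (ℚ; 1ℚ)
open import Relation.Binary.PropositionalEquality using (_≡_; _≢_)

_^ℚ_ : ℚ → ℕ → ℚ
q ^ℚ zero = 1ℚ
q ^ℚ suc n = q ℚ.* (q ^ℚ n)

ℕ→ℚ : ℕ → ℚ
ℕ→ℚ n = + n ℚ./ 1

Σ[<_]_ : (t : ℕ) → (Fin t → ℕ) → ℕ
Σ[< t ] f = sum (map f (allFin t))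

-- A k-uniform cross intersecting matching of size t and type d on the ground
-- set Fin n: the family A i consists of the d i sets A i 0, …, A i (d i - 1).
record IsCrossIntersectingMatching (n k t : ℕ) (d : Fin t → ℕ)
       (A : (i : Fin t) → Fin (d i) → Subset n) : Set where
  field
    t≥2        : 2 ≤ t
    k≥2        : 2 ≤ k
    d≥2        : ∀ i → 2 ≤ d i
    uniform    : ∀ i x → ∣ A i x ∣ ≡ k
    disjoint   : ∀ i x y → x ≢ y → Empty (A i x ∩ A i y)
    cross      : ∀ i j → i ≢ j → ∀ x y → Nonempty (A i x ∩ A j y)

{-# OPTIONS --safe #-}
-- Order the ground set uniformly at random; here this is a sum over all n! orderings. For a ≠ b in
-- one family 𝒜ᵢ the event "all of Aᵢₐ comes before all of Aᵢᵦ" has probability 1/C(2k,k), so the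
-- expected number N of such ordered pairs is ∑ dᵢ(dᵢ-1)/C(2k,k). Cross-intersection rules out such
-- events in two different families at once, and two different events in one family force a triple
-- event (one set before the union of two others, or the union of two before a third), whose
-- probability k!(2k)!/(3k)! is at most (2/3)ᵏ/C(2k,k). Hence N ≤ 1 + k²·#triple events pointwise, and
-- taking expectations with dᵢ ≤ k and t ≤ C(2k,k) gives ∑ dᵢ(dᵢ-1) ≤ (1 + 2k⁵(2/3)ᵏ) C(2k,k).
module Submission where

module Combinatorics where

  open import Data.Bool using (Bool; true; false; _∧_; _∨_; not; if_then_else_) renaming (_≟_ to _≟ᵇ_)
  open import Data.Bool.Properties using (not-¬; ∧-zeroʳ; ∧-identityʳ)
  open import Data.Empty using (⊥-elim)
  open import Data.Fin using (Fin; zero; suc)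
  open import Data.Fin.Properties using (_≟_; any?)
  import Data.Fin.Properties as Fin
  open import Data.Fin.Subset using (Subset) renaming (∣_∣ to ∣_∣ˢ)
  open import Data.Fin.Subset.Properties using (x∈p∩q⁺; x∈p∩q⁻)
  open import Data.List using (List; []; _∷_; tabulate)
  open import Data.List.Properties using (map-tabulate)
  open import Data.Nat using (ℕ; zero; suc; _+_; _*_; _∸_; _^_; _⊓_; _≤_; _<_; z≤n; s≤s; s≤s⁻¹; _!)
  open import Data.Nat.Combinatorics using (_C_; k![n∸k]!∣n!)
  open import Data.Nat.Combinatorics.Specification using (nCk≡n!/k![n-k]!)
  open import Data.Nat.DivMod using (m/n*n≡m)
  import Data.Nat.ListAction as ListAction
  open import Data.Nat.Properties hiding (_≟_)
  open import Algebra.Properties.CommutativeSemigroup *-commutativeSemigroup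
    using (x∙yz≈y∙xz; xy∙z≈xz∙y; xy∙z≈x∙zy; interchange)
  open import Algebra.Properties.Semiring.Sum +-*-semiring
    using (sum; sum-syntax; sum-cong-≗; ∑-distrib-+; ∑-comm; *-distribˡ-sum; *-distribʳ-sum)
  open import Data.Nat.Solver using (module +-*-Solver)
  open import Data.Product using (∃; ∃₂; _×_; _,_; proj₁; proj₂)
  open import Data.Sum using (_⊎_; inj₁; inj₂)
  open import Data.Vec using ([]; _∷_; lookup)
  open import Data.Vec.Properties using ([]=⇒lookup; lookup⇒[]=)
  open import Defs using (IsCrossIntersectingMatching; Σ[<_]_)
  open import Function using (_∘_; id)
  open import Function.Bundles using (_⇔_; mk⇔)
  open import Relation.Binary.PropositionalEquality
  open import Relation.Nullary using (¬_; Dec; yes; no; does; ¬?; _×-dec_)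
  open import Relation.Nullary.Decidable using (dec-true; dec-false; does-⇔)
  open +-*-Solver using (solve; _:=_; con; _:+_; _:*_; _:^_)

  variable
    n d : ℕ

  ∑-const : ∀ n c → ∑[ i < n ] c ≡ n * c
  ∑-const zero    c = refl
  ∑-const (suc n) c = cong (c +_) (∑-const n c)

  ∑-mono-≤ : {f g : Fin n → ℕ} → (∀ i → f i ≤ g i) → sum f ≤ sum g
  ∑-mono-≤ {zero}  f≤g = z≤n
  ∑-mono-≤ {suc n} f≤g = +-mono-≤ (f≤g zero) (∑-mono-≤ (f≤g ∘ suc))

  term≤∑ : (f : Fin n → ℕ) (i : Fin n) → f i ≤ sum f
  term≤∑ f zero    = m≤m+n _ _
  term≤∑ f (suc i) = ≤-trans (term≤∑ (λ j → f (suc j)) i) (m≤n+m _ (f zero))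

  ∑>0⇒∃>0 : (f : Fin n → ℕ) → 0 < sum f → ∃ λ i → 0 < f i
  ∑>0⇒∃>0 {suc n} f ∑>0 with f zero in eq
  ... | suc _ = zero , subst (0 <_) (sym eq) (s≤s z≤n)
  ... | zero with ∑>0⇒∃>0 (λ i → f (suc i)) ∑>0
  ...   | i , fi>0 = suc i , fi>0

  ∑≤1 : (f : Fin n → ℕ) → (∀ i → f i ≤ 1) → (∀ i j → 0 < f i → 0 < f j → i ≡ j) → sum f ≤ 1
  ∑≤1 {zero}  f f≤1 unique = z≤n
  ∑≤1 {suc n} f f≤1 unique with f zero in eq | f≤1 zero
  ... | zero        | _       = ∑≤1 (λ i → f (suc i)) (λ i → f≤1 (suc i))
                                  (λ i j fi>0 fj>0 → Fin.suc-injective (unique (suc i) (suc j) fi>0 fj>0))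
  ... | suc zero    | _       = s≤s (≮⇒≥ rest≯0)
    where
    rest≯0 : ¬ 0 < ∑[ i < n ] f (suc i)
    rest≯0 rest>0 with ∑>0⇒∃>0 (λ i → f (suc i)) rest>0
    ... | j , fj>0 with unique zero (suc j) (subst (0 <_) (sym eq) (s≤s z≤n)) fj>0
    ...   | ()
  ... | suc (suc _) | s≤s ()

  𝟙 : Bool → ℕ
  𝟙 true  = 1
  𝟙 false = 0

  ⟦_⟧ : {A : Set} → Dec A → ℕ
  ⟦ a? ⟧ = 𝟙 (does a?)

  𝟙≤1 : ∀ b → 𝟙 b ≤ 1
  𝟙≤1 true  = s≤s z≤n
  𝟙≤1 false = z≤n

  module _ {A : Set} (a? : Dec A) where

    ⟦⟧≡1 : A → ⟦ a? ⟧ ≡ 1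
    ⟦⟧≡1 a = cong 𝟙 (dec-true a? a)

    ⟦⟧≡0 : ¬ A → ⟦ a? ⟧ ≡ 0
    ⟦⟧≡0 ¬a = cong 𝟙 (dec-false a? ¬a)

  𝟙*-cong : {y z : ℕ} (b : Bool) → (b ≡ true → y ≡ z) → 𝟙 b * y ≡ 𝟙 b * z
  𝟙*-cong true  y≡z = cong (1 *_) (y≡z refl)
  𝟙*-cong false y≡z = refl

  ⟦⟧*-cong : {A : Set} {y z : ℕ} (a? : Dec A) → (A → y ≡ z) → ⟦ a? ⟧ * y ≡ ⟦ a? ⟧ * z
  ⟦⟧*-cong (yes a) y≡z = cong (1 *_) (y≡z a)
  ⟦⟧*-cong (no _)  y≡z = refl

  ⟦⟧*-≤ : {A : Set} {y : ℕ} (a? : Dec A) → ⟦ a? ⟧ * y ≤ y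
  ⟦⟧*-≤ {y = y} (yes _) = ≤-reflexive (*-identityˡ y)
  ⟦⟧*-≤         (no _)  = z≤n

  ⟦⟧*-mono-≤ : {A : Set} {y z : ℕ} (a? : Dec A) → (A → y ≤ z) → ⟦ a? ⟧ * y ≤ ⟦ a? ⟧ * z
  ⟦⟧*-mono-≤ (yes a) y≤z = *-monoʳ-≤ 1 (y≤z a)
  ⟦⟧*-mono-≤ (no _)  y≤z = z≤n

  module _ {A B : Set} where

    ⟦⟧*⟦⟧≤1 : (a? : Dec A) (b? : Dec B) → ⟦ a? ⟧ * ⟦ b? ⟧ ≤ 1
    ⟦⟧*⟦⟧≤1 (yes _) (yes _) = s≤s z≤n
    ⟦⟧*⟦⟧≤1 (yes _) (no _)  = z≤n
    ⟦⟧*⟦⟧≤1 (no _)  _       = z≤n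

    ⟦⟧*⟦⟧≡1 : (a? : Dec A) (b? : Dec B) → A → B → ⟦ a? ⟧ * ⟦ b? ⟧ ≡ 1
    ⟦⟧*⟦⟧≡1 a? b? a b rewrite dec-true a? a | dec-true b? b = refl

    ⟦⟧*⟦⟧>0⇒ : (a? : Dec A) (b? : Dec B) → 0 < ⟦ a? ⟧ * ⟦ b? ⟧ → A × B
    ⟦⟧*⟦⟧>0⇒ (yes a) (yes b) _ = a , b

  Subsetᶠ : ℕ → Set
  Subsetᶠ n = Fin n → Bool

  full : Subsetᶠ n
  full _ = true

  ⁅_⁆ : Fin n → Subsetᶠ n
  ⁅ x ⁆ y = does (x ≟ y)

  infixl 6 _∪_ _─_ _-_
  infix  4 _⊆_

  _∪_ : Subsetᶠ n → Subsetᶠ n → Subsetᶠ n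
  (P ∪ Q) x = P x ∨ Q x

  _─_ : Subsetᶠ n → Subsetᶠ n → Subsetᶠ n
  (P ─ Q) x = P x ∧ not (Q x)

  _-_ : Subsetᶠ n → Fin n → Subsetᶠ n
  P - x = P ─ ⁅ x ⁆

  _⊆_ : Subsetᶠ n → Subsetᶠ n → Set
  P ⊆ Q = ∀ x → P x ≡ true → Q x ≡ true

  Disjoint : Subsetᶠ n → Subsetᶠ n → Set
  Disjoint P Q = ∀ x → P x ≡ true → Q x ≡ false

  Nonempty : Subsetᶠ n → Set
  Nonempty P = ∃ λ x → P x ≡ true

  size : Subsetᶠ n → ℕ
  size {n} P = ∑[ x < n ] 𝟙 (P x)

  module _ (P : Subsetᶠ n) (x : Fin n) where

    x∉P-x : (P - x) x ≡ false
    x∉P-x rewrite dec-true (x ≟ x) refl = ∧-zeroʳ (P x)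

    y∈P-x⇔y∈P : ∀ {y} → x ≢ y → (P - x) y ≡ P y
    y∈P-x⇔y∈P {y} x≢y rewrite dec-false (x ≟ y) x≢y = ∧-identityʳ (P y)

  module _ (P : Subsetᶠ n) (x : Fin n) {y : Fin n} where

    ∈P-x⇒≢ : (P - x) y ≡ true → x ≢ y
    ∈P-x⇒≢ y∈P-x refl = not-¬ y∈P-x (x∉P-x P x)

    ∈P-x⇒∈P : (P - x) y ≡ true → P y ≡ true
    ∈P-x⇒∈P y∈P-x = trans (sym (y∈P-x⇔y∈P P x (∈P-x⇒≢ y∈P-x))) y∈P-x

  module _ {S : Subsetᶠ n} (x : Fin n) where

    ⊆-remove : {P : Subsetᶠ n} → P ⊆ S → P x ≡ false → P ⊆ S - x
    ⊆-remove {P} P⊆S Px y Py = trans (y∈P-x⇔y∈P S x x≢y) (P⊆S y Py)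
      where
      x≢y : x ≢ y
      x≢y refl = not-¬ Py Px

    remove-mono-⊆ : {P : Subsetᶠ n} → P ⊆ S → P - x ⊆ S - x
    remove-mono-⊆ {P} P⊆S y y∈P-x = trans (y∈P-x⇔y∈P S x (∈P-x⇒≢ P x y∈P-x)) (P⊆S y (∈P-x⇒∈P P x y∈P-x))

    remove-disjoint : {Q : Subsetᶠ n} → Disjoint S Q → Disjoint (S - x) Q
    remove-disjoint S∩Q=∅ y y∈S-x = S∩Q=∅ y (∈P-x⇒∈P S x y∈S-x)

  Disjoint-∪ʳ : {P Q R : Subsetᶠ n} → Disjoint P Q → Disjoint P R → Disjoint P (Q ∪ R)
  Disjoint-∪ʳ P∩Q=∅ P∩R=∅ x Px rewrite P∩Q=∅ x Px | P∩R=∅ x Px = refl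

  Disjoint-∪ˡ : {P Q R : Subsetᶠ n} → Disjoint P R → Disjoint Q R → Disjoint (P ∪ Q) R
  Disjoint-∪ˡ {P = P} P∩R=∅ Q∩R=∅ x Px∨Qx with P x in Px
  ... | true  = P∩R=∅ x Px
  ... | false = Q∩R=∅ x Px∨Qx

  size-full : size (full {n}) ≡ n
  size-full {n} = trans (∑-const n 1) (*-identityʳ n)

  size-⁅⁆ : (x : Fin n) → size ⁅ x ⁆ ≡ 1
  size-⁅⁆ {suc n} zero    = cong suc (trans (∑-const n 0) (*-zeroʳ n))
  size-⁅⁆ {suc n} (suc x) = size-⁅⁆ x

  size-─ : {S T : Subsetᶠ n} → T ⊆ S → size S ≡ size T + size (S ─ T)
  size-─ {n} {S} {T} T⊆S = trans (sum-cong-≗ split) (∑-distrib-+ (λ x → 𝟙 (T x)) (λ x → 𝟙 ((S ─ T) x)))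
    where
    split : ∀ x → 𝟙 (S x) ≡ 𝟙 (T x) + 𝟙 (S x ∧ not (T x))
    split x with T x in Tx
    ... | true  rewrite T⊆S x Tx = refl
    ... | false with S x
    ...   | true  = refl
    ...   | false = refl

  size-∪ : {P Q : Subsetᶠ n} → Disjoint P Q → size (P ∪ Q) ≡ size P + size Q
  size-∪ {n} {P} {Q} P∩Q=∅ = trans (sum-cong-≗ split) (∑-distrib-+ (λ x → 𝟙 (P x)) (λ x → 𝟙 (Q x)))
    where
    split : ∀ x → 𝟙 (P x ∨ Q x) ≡ 𝟙 (P x) + 𝟙 (Q x)
    split x with P x in Px
    ... | true  rewrite P∩Q=∅ x Px = refl
    ... | false = refl

  size-remove : {S : Subsetᶠ n} {m : ℕ} (x : Fin n) → S x ≡ true → size S ≡ suc m → size (S - x) ≡ m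
  size-remove {S = S} {m} x x∈S ∣S∣≡1+m = suc-injective (begin
    suc (size (S - x))        ≡⟨ cong (_+ size (S - x)) (size-⁅⁆ x) ⟨
    size ⁅ x ⁆ + size (S - x) ≡⟨ size-─ ⁅x⁆⊆S ⟨
    size S                    ≡⟨ ∣S∣≡1+m ⟩
    suc m                     ∎)
    where
    open ≡-Reasoning
    ⁅x⁆⊆S : ⁅ x ⁆ ⊆ S
    ⁅x⁆⊆S y x≡y with x ≟ y
    ⁅x⁆⊆S y x≡y | yes refl = x∈S

  size-mono : {P Q : Subsetᶠ n} → P ⊆ Q → size P ≤ size Q
  size-mono {P = P} {Q} P⊆Q = ∑-mono-≤ λ x → 𝟙-mono (P x) (Q x) (P⊆Q x)
    where
    𝟙-mono : ∀ b c → (b ≡ true → c ≡ true) → 𝟙 b ≤ 𝟙 c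
    𝟙-mono true  c b⇒c rewrite b⇒c refl = ≤-refl
    𝟙-mono false c b⇒c = z≤n

  size≡0⇒∅ : (P : Subsetᶠ n) → size P ≡ 0 → ∀ x → P x ≡ false
  size≡0⇒∅ P ∣P∣≡0 x with P x in Px
  ... | false = refl
  ... | true  = ⊥-elim (n≮0 (subst (1 ≤_) ∣P∣≡0 (subst (λ b → 𝟙 b ≤ size P) Px (term≤∑ (λ y → 𝟙 (P y)) x))))

  size>0⇒Nonempty : (P : Subsetᶠ n) → 0 < size P → Nonempty P
  size>0⇒Nonempty P size>0 with ∑>0⇒∃>0 (λ x → 𝟙 (P x)) size>0
  ... | x , Px>0 with P x in Px
  ...   | true = x , Px

  ∪-⊆ : {P Q S : Subsetᶠ n} → P ⊆ S → Q ⊆ S → P ∪ Q ⊆ S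
  ∪-⊆ {P = P} P⊆S Q⊆S x Px∨Qx with P x in Px
  ... | true  = P⊆S x Px
  ... | false = Q⊆S x Px∨Qx

  ∑-piecewise : {S P Q : Subsetᶠ n} {h : Fin n → ℕ} {K₁ K₂ : ℕ} → P ⊆ S → Q ⊆ S → Disjoint P Q →
                (∀ x → S x ≡ true → P x ≡ true → h x ≡ K₁) → (∀ x → Q x ≡ true → h x ≡ 0) →
                (∀ x → S x ≡ true → P x ≡ false → Q x ≡ false → h x ≡ K₂) →
                ∑[ x < n ] (𝟙 (S x) * h x) ≡ size P * K₁ + size (S ─ (P ∪ Q)) * K₂
  ∑-piecewise {n} {S} {P} {Q} {h} {K₁} {K₂} P⊆S Q⊆S P∩Q=∅ on-P on-Q off-P∪Q = begin
    ∑[ x < n ] (𝟙 (S x) * h x)                                ≡⟨ sum-cong-≗ {n} pointwise ⟩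
    ∑[ x < n ] (𝟙 (P x) * K₁ + 𝟙 (R x) * K₂)                  ≡⟨ ∑-distrib-+ {n} _ _ ⟩
    ∑[ x < n ] (𝟙 (P x) * K₁) + ∑[ x < n ] (𝟙 (R x) * K₂)
                                       ≡⟨ cong₂ _+_ (*-distribʳ-sum {n} K₁ _) (*-distribʳ-sum {n} K₂ _) ⟨
    size P * K₁ + size R * K₂                                 ∎
    where
    open ≡-Reasoning
    R = S ─ (P ∪ Q)
    pointwise : ∀ x → 𝟙 (S x) * h x ≡ 𝟙 (P x) * K₁ + 𝟙 (R x) * K₂
    pointwise x with P x in Px | Q x in Qx | S x in Sx
    ... | true  | true  | _     = ⊥-elim (not-¬ Qx (P∩Q=∅ x Px))
    ... | true  | false | false = ⊥-elim (not-¬ (P⊆S x Px) Sx)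
    ... | false | true  | false = ⊥-elim (not-¬ (Q⊆S x Qx) Sx)
    ... | false | false | false = refl
    ... | true  | false | true  = cong (1 *_) (trans (on-P x Sx Px) (sym (+-identityʳ K₁)))
    ... | false | true  | true  = cong (1 *_) (on-Q x Qx)
    ... | false | false | true  = cong (1 *_) (off-P∪Q x Sx Px Qx)

  _≢?_ : (a b : Fin d) → Dec (a ≢ b)
  a ≢? b = ¬? (a ≟ b)

  ∑-≢ : (a : Fin d) → ∑[ b < d ] ⟦ a ≢? b ⟧ ≡ d ∸ 1
  ∑-≢ {suc d} a = size-remove a refl size-full

  Distinct₃ : Fin d → Fin d → Fin d → Set
  Distinct₃ a b c = a ≢ b × a ≢ c × b ≢ c

  distinct₃? : (a b c : Fin d) → Dec (Distinct₃ a b c)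
  distinct₃? a b c = a ≢? b ×-dec a ≢? c ×-dec b ≢? c

  another : ∀ {m} → 2 ≤ m → (i : Fin m) → ∃ λ j → i ≢ j
  another (s≤s (s≤s _)) zero    = suc zero , λ ()
  another (s≤s (s≤s _)) (suc i) = zero , λ ()

  two-distinct : ∀ {m} → 2 ≤ m → ∃₂ λ (a b : Fin m) → a ≢ b
  two-distinct (s≤s (s≤s _)) = zero , suc zero , λ ()

  position : List (Fin n) → Fin n → ℕ
  position []      y = 0
  position (x ∷ π) y = if does (x ≟ y) then 0 else suc (position π y)

  position-head : (x : Fin n) (π : List (Fin n)) → position (x ∷ π) x ≡ 0
  position-head x π rewrite dec-true (x ≟ x) refl = refl

  position-tail : {x y : Fin n} (π : List (Fin n)) → x ≢ y → position (x ∷ π) y ≡ suc (position π y)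
  position-tail {x = x} {y} π x≢y rewrite dec-false (x ≟ y) x≢y = refl

  record _≺[_]_ (P : Subsetᶠ n) (π : List (Fin n)) (Q : Subsetᶠ n) : Set where
    constructor mk≺
    field
      ≺⇒< : ∀ p q → P p ≡ true → Q q ≡ true → position π p < position π q

  open _≺[_]_

  Inversion : Subsetᶠ n → List (Fin n) → Subsetᶠ n → Set
  Inversion P π Q = ∃₂ λ p q → P p ≡ true × Q q ≡ true × position π q ≤ position π p

  ≺-or-inversion : (P : Subsetᶠ n) (π : List (Fin n)) (Q : Subsetᶠ n) → P ≺[ π ] Q ⊎ Inversion P π Q
  ≺-or-inversion P π Q
    with any? (λ p → any? λ q → (P p ≟ᵇ true) ×-dec (Q q ≟ᵇ true) ×-dec (position π q ≤? position π p))
  ... | yes (p , q , Pp , Qq , q≤p) = inj₂ (p , q , Pp , Qq , q≤p)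
  ... | no ∄inversion = inj₁ (mk≺ λ p q Pp Qq → ≰⇒> λ q≤p → ∄inversion (p , q , Pp , Qq , q≤p))

  ≺⇒¬inversion : {P Q : Subsetᶠ n} {π : List (Fin n)} → P ≺[ π ] Q → ¬ Inversion P π Q
  ≺⇒¬inversion P≺Q (p , q , Pp , Qq , q≤p) = <⇒≱ (≺⇒< P≺Q p q Pp Qq) q≤p

  _≺?[_]_ : (P : Subsetᶠ n) (π : List (Fin n)) (Q : Subsetᶠ n) → Dec (P ≺[ π ] Q)
  P ≺?[ π ] Q with ≺-or-inversion P π Q
  ... | inj₁ P≺Q       = yes P≺Q
  ... | inj₂ inversion = no λ P≺Q → ≺⇒¬inversion P≺Q inversion

  module _ {π : List (Fin n)} where

    ≺-trans : {P Q R : Subsetᶠ n} → Nonempty Q → P ≺[ π ] Q → Q ≺[ π ] R → P ≺[ π ] R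
    ≺-trans (q , Qq) P≺Q Q≺R = mk≺ λ p r Pp Rr → <-trans (≺⇒< P≺Q p q Pp Qq) (≺⇒< Q≺R q r Qq Rr)

    ≺-asym : {P Q : Subsetᶠ n} → Nonempty P → Nonempty Q → P ≺[ π ] Q → ¬ Q ≺[ π ] P
    ≺-asym (p , Pp) (q , Qq) P≺Q Q≺P = <-asym (≺⇒< P≺Q p q Pp Qq) (≺⇒< Q≺P q p Qq Pp)

    ≺-∪ʳ : {P Q R : Subsetᶠ n} → P ≺[ π ] Q → P ≺[ π ] R → P ≺[ π ] (Q ∪ R)
    ≺-∪ʳ {P} {Q} {R} P≺Q P≺R = mk≺ λ p q Pp Qq∨Rq → case-on-Q p q Pp Qq∨Rq
      where
      case-on-Q : ∀ p q → P p ≡ true → (Q q ∨ R q) ≡ true → position π p < position π q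
      case-on-Q p q Pp Qq∨Rq with Q q in Qq
      ... | true  = ≺⇒< P≺Q p q Pp Qq
      ... | false = ≺⇒< P≺R p q Pp Qq∨Rq

    ≺-∪ˡ : {P Q R : Subsetᶠ n} → P ≺[ π ] R → Q ≺[ π ] R → (P ∪ Q) ≺[ π ] R
    ≺-∪ˡ {P} {Q} {R} P≺R Q≺R = mk≺ λ p r Pp∨Qp Rr → case-on-P p r Pp∨Qp Rr
      where
      case-on-P : ∀ p r → (P p ∨ Q p) ≡ true → R r ≡ true → position π p < position π r
      case-on-P p r Pp∨Qp Rr with P p in Pp
      ... | true  = ≺⇒< P≺R p r Pp Rr
      ... | false = ≺⇒< Q≺R p r Pp∨Qp Rr

    ≺-interleave : {P Q R S : Subsetᶠ n} → P ≺[ π ] Q → R ≺[ π ] S → P ≺[ π ] S ⊎ R ≺[ π ] Q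
    ≺-interleave {P} {Q} {R} {S} P≺Q R≺S with ≺-or-inversion P π S | ≺-or-inversion R π Q
    ... | inj₁ P≺S | _        = inj₁ P≺S
    ... | inj₂ _   | inj₁ R≺Q = inj₂ R≺Q
    ... | inj₂ (p , s , Pp , Ss , s≤p) | inj₂ (r , q , Rr , Qq , q≤r) =
      ⊥-elim (<-irrefl refl (begin-strict
        position π q <⟨ ≤-<-trans q≤r (≺⇒< R≺S r s Rr Ss) ⟩
        position π s ≤⟨ s≤p ⟩
        position π p <⟨ ≺⇒< P≺Q p q Pp Qq ⟩
        position π q ∎))
      where open ≤-Reasoning

  module _ {P Q : Subsetᶠ n} (x : Fin n) (π : List (Fin n)) where

    ≺-∷-∈P : P x ≡ true → Disjoint P Q → P ≺[ x ∷ π ] Q ⇔ (P - x) ≺[ π ] Q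
    ≺-∷-∈P Px P∩Q=∅ = mk⇔ to from
      where
      x≢q : ∀ {q} → Q q ≡ true → x ≢ q
      x≢q Qq refl = not-¬ Qq (P∩Q=∅ x Px)
      to : P ≺[ x ∷ π ] Q → (P - x) ≺[ π ] Q
      to P≺Q = mk≺ λ p q p∈P-x Qq → s≤s⁻¹ (subst₂ _<_
        (position-tail π (∈P-x⇒≢ P x p∈P-x)) (position-tail π (x≢q Qq))
        (≺⇒< P≺Q p q (∈P-x⇒∈P P x p∈P-x) Qq))
      from-at : (P - x) ≺[ π ] Q → ∀ p q → P p ≡ true → Q q ≡ true → position (x ∷ π) p < position (x ∷ π) q
      from-at P-x≺Q p q Pp Qq with x ≟ p
      ... | yes refl = subst (0 <_) (sym (position-tail π (x≢q Qq))) (s≤s z≤n)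
      ... | no x≢p   = subst (suc (position π p) <_) (sym (position-tail π (x≢q Qq)))
                         (s≤s (≺⇒< P-x≺Q p q (trans (y∈P-x⇔y∈P P x x≢p) Pp) Qq))
      from : (P - x) ≺[ π ] Q → P ≺[ x ∷ π ] Q
      from P-x≺Q = mk≺ (from-at P-x≺Q)

    ≺-∷-∈Q : Q x ≡ true → Nonempty P → ¬ P ≺[ x ∷ π ] Q
    ≺-∷-∈Q Qx (p , Pp) P≺Q = n≮0 (subst (position (x ∷ π) p <_) (position-head x π) (≺⇒< P≺Q p x Pp Qx))

    ≺-∷-∉ : P x ≡ false → Q x ≡ false → P ≺[ x ∷ π ] Q ⇔ P ≺[ π ] Q
    ≺-∷-∉ Px Qx = mk⇔
      (λ P≺Q → mk≺ λ p q Pp Qq → s≤s⁻¹ (subst₂ _<_ (position-tail π (x≢ P Pp Px)) (position-tail π (x≢ Q Qq Qx))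
                                                    (≺⇒< P≺Q p q Pp Qq)))
      (λ P≺Q → mk≺ λ p q Pp Qq → subst₂ _<_ (sym (position-tail π (x≢ P Pp Px))) (sym (position-tail π (x≢ Q Qq Qx)))
                                              (s≤s (≺⇒< P≺Q p q Pp Qq)))
      where
      x≢ : ∀ (R : Subsetᶠ n) {y} → R y ≡ true → R x ≡ false → x ≢ y
      x≢ R Ry Rx refl = not-¬ Ry Rx

  ≺-∅ : {P Q : Subsetᶠ n} {π : List (Fin n)} → (∀ p → P p ≡ false) → P ≺[ π ] Q
  ≺-∅ P=∅ = mk≺ λ p q Pp → ⊥-elim (not-¬ Pp (P=∅ p))

  -- When size S ≡ m, ∑ₐ m S f sums f over the m! orderings of S, listed by their first element;
  -- it replaces m! times the expectation over a uniformly random ordering.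
  ∑ₐ : (m : ℕ) → Subsetᶠ n → (List (Fin n) → ℕ) → ℕ
  ∑ₐ     zero    S f = f []
  ∑ₐ {n} (suc m) S f = ∑[ x < n ] (𝟙 (S x) * ∑ₐ m (S - x) (λ π → f (x ∷ π)))

  ∑ₐ-cong : ∀ m (S : Subsetᶠ n) {f g : List (Fin n) → ℕ} → (∀ π → f π ≡ g π) → ∑ₐ m S f ≡ ∑ₐ m S g
  ∑ₐ-cong zero    S f≗g = f≗g []
  ∑ₐ-cong (suc m) S f≗g = sum-cong-≗ λ x → cong (𝟙 (S x) *_) (∑ₐ-cong m (S - x) λ π → f≗g (x ∷ π))

  ∑ₐ-mono-≤ : ∀ m (S : Subsetᶠ n) {f g : List (Fin n) → ℕ} → (∀ π → f π ≤ g π) → ∑ₐ m S f ≤ ∑ₐ m S g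
  ∑ₐ-mono-≤ zero    S f≤g = f≤g []
  ∑ₐ-mono-≤ (suc m) S f≤g = ∑-mono-≤ λ x → *-monoʳ-≤ (𝟙 (S x)) (∑ₐ-mono-≤ m (S - x) λ π → f≤g (x ∷ π))

  ∑ₐ-distrib-+ : ∀ m (S : Subsetᶠ n) (f g : List (Fin n) → ℕ) →
                 ∑ₐ m S (λ π → f π + g π) ≡ ∑ₐ m S f + ∑ₐ m S g
  ∑ₐ-distrib-+ zero    S f g = refl
  ∑ₐ-distrib-+ {n} (suc m) S f g = trans (sum-cong-≗ split) (∑-distrib-+ {n} _ _)
    where
    split : ∀ x → 𝟙 (S x) * ∑ₐ m (S - x) (λ π → f (x ∷ π) + g (x ∷ π))
                ≡ 𝟙 (S x) * ∑ₐ m (S - x) (λ π → f (x ∷ π)) + 𝟙 (S x) * ∑ₐ m (S - x) (λ π → g (x ∷ π))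
    split x = trans (cong (𝟙 (S x) *_) (∑ₐ-distrib-+ m (S - x) _ _)) (*-distribˡ-+ (𝟙 (S x)) _ _)

  ∑ₐ-*ˡ : ∀ m (S : Subsetᶠ n) c (f : List (Fin n) → ℕ) → ∑ₐ m S (λ π → c * f π) ≡ c * ∑ₐ m S f
  ∑ₐ-*ˡ zero    S c f = refl
  ∑ₐ-*ˡ {n} (suc m) S c f = trans (sum-cong-≗ pull) (sym (*-distribˡ-sum {n} c _))
    where
    pull : ∀ x → 𝟙 (S x) * ∑ₐ m (S - x) (λ π → c * f (x ∷ π)) ≡ c * (𝟙 (S x) * ∑ₐ m (S - x) (λ π → f (x ∷ π)))
    pull x = trans (cong (𝟙 (S x) *_) (∑ₐ-*ˡ m (S - x) c _)) (x∙yz≈y∙xz (𝟙 (S x)) c _)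

  ∑ₐ-zero : ∀ m (S : Subsetᶠ n) → ∑ₐ m S (λ _ → 0) ≡ 0
  ∑ₐ-zero m S = ∑ₐ-*ˡ m S 0 (λ _ → 0)

  ∑ₐ-∑ : ∀ m (S : Subsetᶠ n) t (f : Fin t → List (Fin n) → ℕ) →
         ∑ₐ m S (λ π → ∑[ i < t ] f i π) ≡ ∑[ i < t ] ∑ₐ m S (f i)
  ∑ₐ-∑ m S zero    f = ∑ₐ-zero m S
  ∑ₐ-∑ m S (suc t) f = trans (∑ₐ-distrib-+ m S (f zero) (λ π → ∑[ i < t ] f (suc i) π))
                             (cong (∑ₐ m S (f zero) +_) (∑ₐ-∑ m S t (λ i → f (suc i))))

  ∑ₐ-1 : ∀ m (S : Subsetᶠ n) → size S ≡ m → ∑ₐ m S (λ _ → 1) ≡ m !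
  ∑ₐ-1 zero    S _       = refl
  ∑ₐ-1 {n} (suc m) S ∣S∣≡1+m = begin
    ∑[ x < n ] (𝟙 (S x) * ∑ₐ m (S - x) (λ _ → 1)) ≡⟨ sum-cong-≗ (λ x → 𝟙*-cong (S x) λ Sx →
                                                       ∑ₐ-1 m (S - x) (size-remove x Sx ∣S∣≡1+m)) ⟩
    ∑[ x < n ] (𝟙 (S x) * m !)                    ≡⟨ *-distribʳ-sum {n} (m !) _ ⟨
    size S * m !                                  ≡⟨ cong (_* m !) ∣S∣≡1+m ⟩
    suc m * m !                                   ∎
    where open ≡-Reasoning

  ⟪_≺_⟫ : Subsetᶠ n → Subsetᶠ n → List (Fin n) → ℕ
  ⟪ P ≺ Q ⟫ π = ⟦ P ≺?[ π ] Q ⟧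

  ⟪⟫-cong : {P Q P′ Q′ : Subsetᶠ n} {π π′ : List (Fin n)} →
            P ≺[ π ] Q ⇔ P′ ≺[ π′ ] Q′ → ⟪ P ≺ Q ⟫ π ≡ ⟪ P′ ≺ Q′ ⟫ π′
  ⟪⟫-cong {P = P} {Q} {P′} {Q′} {π} {π′} P≺Q⇔P′≺Q′ = cong 𝟙 (does-⇔ P≺Q⇔P′≺Q′ (P ≺?[ π ] Q) (P′ ≺?[ π′ ] Q′))

  ∑ₐ-≺ : ∀ m a b {S P Q : Subsetᶠ n} → size S ≡ m → size P ≡ a → size Q ≡ b →
         P ⊆ S → Q ⊆ S → Disjoint P Q → ∑ₐ m S ⟪ P ≺ Q ⟫ * (a + b) ! ≡ m ! * (a ! * b !)
  ∑ₐ-≺ m zero b {S} {P} {Q} ∣S∣≡m ∣P∣≡0 _ _ _ _ = begin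
    ∑ₐ m S ⟪ P ≺ Q ⟫ * b ! ≡⟨ cong (_* b !) (∑ₐ-cong m S λ π → ⟦⟧≡1 (P ≺?[ π ] Q) (≺-∅ (size≡0⇒∅ P ∣P∣≡0))) ⟩
    ∑ₐ m S (λ _ → 1) * b ! ≡⟨ cong (_* b !) (∑ₐ-1 m S ∣S∣≡m) ⟩
    m ! * b !              ≡⟨ cong (m ! *_) (+-identityʳ (b !)) ⟨
    m ! * (1 * b !)        ∎
    where open ≡-Reasoning
  ∑ₐ-≺ zero (suc a) b ∣S∣≡0 ∣P∣≡1+a _ P⊆S _ _ =
    ⊥-elim (n≮0 (subst₂ _≤_ ∣P∣≡1+a ∣S∣≡0 (size-mono P⊆S)))
  ∑ₐ-≺ {n} (suc m) (suc a) b {S} {P} {Q} ∣S∣≡1+m ∣P∣≡1+a ∣Q∣≡b P⊆S Q⊆S P∩Q=∅ = begin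
    ∑[ x < n ] (𝟙 (S x) * g x) * F                ≡⟨ *-distribʳ-sum {n} F _ ⟩
    ∑[ x < n ] (𝟙 (S x) * g x * F)                ≡⟨ sum-cong-≗ {n} (λ x → *-assoc (𝟙 (S x)) (g x) F) ⟩
    ∑[ x < n ] (𝟙 (S x) * (g x * F))              ≡⟨ ∑-piecewise P⊆S Q⊆S P∩Q=∅ head-in-P head-in-Q head-outside ⟩
    size P * K₁ + size (S ─ (P ∪ Q)) * K₂         ≡⟨ cong (λ p → p * K₁ + size (S ─ (P ∪ Q)) * K₂) ∣P∣≡1+a ⟩
    suc a * K₁ + size (S ─ (P ∪ Q)) * K₂          ≡⟨ collect a b (size (S ─ (P ∪ Q))) (m !) (a !) (b !) ⟩
    (suc a + b + size (S ─ (P ∪ Q))) * m ! * (suc a ! * b !)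
                                                  ≡⟨ cong (λ s → s * m ! * (suc a ! * b !)) ∣S∣≡1+a+b+r ⟩
    suc m * m ! * (suc a ! * b !)                 ∎
    where
    open ≡-Reasoning
    F  = (suc a + b) !
    K₁ = (suc a + b) * (m ! * (a ! * b !))
    K₂ = m ! * (suc a ! * b !)

    g : Fin n → ℕ
    g x = ∑ₐ m (S - x) (λ π → ⟪ P ≺ Q ⟫ (x ∷ π))

    ∣S∣≡1+a+b+r : suc a + b + size (S ─ (P ∪ Q)) ≡ suc m
    ∣S∣≡1+a+b+r = begin
      suc a + b + size (S ─ (P ∪ Q))          ≡⟨ cong₂ (λ p q → p + q + size (S ─ (P ∪ Q))) ∣P∣≡1+a ∣Q∣≡b ⟨
      size P + size Q + size (S ─ (P ∪ Q))    ≡⟨ cong (_+ size (S ─ (P ∪ Q))) (size-∪ P∩Q=∅) ⟨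
      size (P ∪ Q) + size (S ─ (P ∪ Q))       ≡⟨ size-─ (∪-⊆ P⊆S Q⊆S) ⟨
      size S                                  ≡⟨ ∣S∣≡1+m ⟩
      suc m                                   ∎

    head-in-P : ∀ x → S x ≡ true → P x ≡ true → g x * F ≡ K₁
    head-in-P x Sx Px = begin
      g x * F
        ≡⟨ cong (_* F) (∑ₐ-cong m (S - x) λ π → ⟪⟫-cong (≺-∷-∈P x π Px P∩Q=∅)) ⟩
      ∑ₐ m (S - x) ⟪ P - x ≺ Q ⟫ * (suc (a + b) * (a + b) !)
        ≡⟨ x∙yz≈y∙xz (∑ₐ m (S - x) ⟪ P - x ≺ Q ⟫) (suc (a + b)) ((a + b) !) ⟩
      suc (a + b) * (∑ₐ m (S - x) ⟪ P - x ≺ Q ⟫ * (a + b) !)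
        ≡⟨ cong (suc (a + b) *_) (∑ₐ-≺ m a b (size-remove x Sx ∣S∣≡1+m) (size-remove x Px ∣P∣≡1+a) ∣Q∣≡b
                                          (remove-mono-⊆ x P⊆S) (⊆-remove x Q⊆S (P∩Q=∅ x Px)) (remove-disjoint x P∩Q=∅)) ⟩
      K₁ ∎

    head-in-Q : ∀ x → Q x ≡ true → g x * F ≡ 0
    head-in-Q x Qx = cong (_* F) (trans (∑ₐ-cong m (S - x) λ π → ⟦⟧≡0 (P ≺?[ x ∷ π ] Q) (≺-∷-∈Q x π Qx P≢∅))
                                        (∑ₐ-zero m (S - x)))
      where
      P≢∅ : Nonempty P
      P≢∅ = size>0⇒Nonempty P (subst (0 <_) (sym ∣P∣≡1+a) (s≤s z≤n))

    head-outside : ∀ x → S x ≡ true → P x ≡ false → Q x ≡ false → g x * F ≡ K₂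
    head-outside x Sx Px Qx = begin
      g x * F                           ≡⟨ cong (_* F) (∑ₐ-cong m (S - x) λ π → ⟪⟫-cong (≺-∷-∉ x π Px Qx)) ⟩
      ∑ₐ m (S - x) ⟪ P ≺ Q ⟫ * F        ≡⟨ ∑ₐ-≺ m (suc a) b (size-remove x Sx ∣S∣≡1+m) ∣P∣≡1+a ∣Q∣≡b
                                             (⊆-remove x P⊆S Px) (⊆-remove x Q⊆S Qx) P∩Q=∅ ⟩
      K₂                                ∎

    collect : ∀ a b r M A B → suc a * ((suc a + b) * (M * (A * B))) + r * (M * (suc a * A * B))
                            ≡ (suc a + b + r) * M * (suc a * A * B)
    collect = solve 6 (λ a b r M A B → (con 1 :+ a) :* ((con 1 :+ a :+ b) :* (M :* (A :* B)))
                                         :+ r :* (M :* ((con 1 :+ a) :* A :* B))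
                                     := (con 1 :+ a :+ b :+ r) :* M :* ((con 1 :+ a) :* A :* B)) refl

  binomial-factorials : ∀ {m k} → k ≤ m → (m C k) * (k ! * (m ∸ k) !) ≡ m !
  binomial-factorials {m} {k} k≤m =
    trans (cong (_* (k ! * (m ∸ k) !)) (nCk≡n!/k![n-k]! k≤m)) (m/n*n≡m {{k !* (m ∸ k) !≢0}} (k![n∸k]!∣n! k≤m))

  central-binomial : ∀ k → ((2 * k) C k) * (k ! * k !) ≡ (k + k) !
  central-binomial k = begin
    ((2 * k) C k) * (k ! * k !)             ≡⟨ cong (λ m → (m C k) * (k ! * k !)) 2k≡k+k ⟩
    ((k + k) C k) * (k ! * k !)             ≡⟨ cong (λ j → ((k + k) C k) * (k ! * j !)) (m+n∸m≡n k k) ⟨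
    ((k + k) C k) * (k ! * (k + k ∸ k) !)   ≡⟨ binomial-factorials (m≤m+n k k) ⟩
    (k + k) !                               ∎
    where
    open ≡-Reasoning
    2k≡k+k : 2 * k ≡ k + k
    2k≡k+k = cong (k +_) (+-identityʳ k)

  3^k*[2k]!²≤2^k*[3k]!*k! : ∀ k → 3 ^ k * ((k + k) ! * (k + k) !) ≤ 2 ^ k * ((k + (k + k)) ! * k !)
  3^k*[2k]!²≤2^k*[3k]!*k! zero    = ≤-refl
  3^k*[2k]!²≤2^k*[3k]!*k! (suc k) = begin
    3 ^ suc k * ((suc k + suc k) ! * (suc k + suc k) !)
      ≡⟨ cong (λ m → 3 ^ suc k * (m ! * m !)) (2[1+k]≡2+2k k) ⟩
    3 * 3 ^ k * ((2 + (k + k)) * ((1 + (k + k)) * F₂) * ((2 + (k + k)) * ((1 + (k + k)) * F₂)))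
      ≡⟨ regroup₂ (3 ^ k) (2 + (k + k)) (1 + (k + k)) F₂ ⟩
    3 ^ k * (F₂ * F₂) * (3 * ((2 + (k + k)) * (2 + (k + k)) * ((1 + (k + k)) * (1 + (k + k)))))
      ≤⟨ *-mono-≤ (3^k*[2k]!²≤2^k*[3k]!*k! k) (step-ratio k) ⟩
    2 ^ k * (F₃ * k !) * (2 * ((3 + (k + (k + k))) * (2 + (k + (k + k))) * (1 + (k + (k + k))) * suc k))
      ≡⟨ regroup₃ (2 ^ k) F₃ (k !) (3 + (k + (k + k))) (2 + (k + (k + k))) (1 + (k + (k + k))) (suc k) ⟩
    2 * 2 ^ k * ((3 + (k + (k + k))) * ((2 + (k + (k + k))) * ((1 + (k + (k + k))) * F₃)) * (suc k * k !))
      ≡⟨ cong (λ m → 2 ^ suc k * (m ! * suc k !)) (3[1+k]≡3+3k k) ⟨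
    2 ^ suc k * ((suc k + (suc k + suc k)) ! * suc k !) ∎
    where
    open ≤-Reasoning
    F₂ = (k + k) !
    F₃ = (k + (k + k)) !

    2[1+k]≡2+2k : ∀ k → suc k + suc k ≡ 2 + (k + k)
    2[1+k]≡2+2k = solve 1 (λ k → (con 1 :+ k) :+ (con 1 :+ k) := con 2 :+ (k :+ k)) refl

    3[1+k]≡3+3k : ∀ k → suc k + (suc k + suc k) ≡ 3 + (k + (k + k))
    3[1+k]≡3+3k = solve 1 (λ k → (con 1 :+ k) :+ ((con 1 :+ k) :+ (con 1 :+ k)) := con 3 :+ (k :+ (k :+ k))) refl

    step-ratio : ∀ k → 3 * ((2 + (k + k)) * (2 + (k + k)) * ((1 + (k + k)) * (1 + (k + k))))
                     ≤ 2 * ((3 + (k + (k + k))) * (2 + (k + (k + k))) * (1 + (k + (k + k))) * suc k)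
    step-ratio k = ≤-trans (m≤m+n _ (6 * (suc k * suc k * k * suc k))) (≤-reflexive (gap k))
      where
      gap : ∀ k → 3 * ((2 + (k + k)) * (2 + (k + k)) * ((1 + (k + k)) * (1 + (k + k)))) + 6 * (suc k * suc k * k * suc k)
                ≡ 2 * ((3 + (k + (k + k))) * (2 + (k + (k + k))) * (1 + (k + (k + k))) * suc k)
      gap = solve 1 (λ k → con 3 :* ((con 2 :+ (k :+ k)) :* (con 2 :+ (k :+ k))
                                      :* ((con 1 :+ (k :+ k)) :* (con 1 :+ (k :+ k))))
                             :+ con 6 :* ((con 1 :+ k) :* (con 1 :+ k) :* k :* (con 1 :+ k))
                         := con 2 :* ((con 3 :+ (k :+ (k :+ k))) :* (con 2 :+ (k :+ (k :+ k)))
                                      :* (con 1 :+ (k :+ (k :+ k))) :* (con 1 :+ k))) refl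

    regroup₂ : ∀ t a b f → 3 * t * (a * (b * f) * (a * (b * f))) ≡ t * (f * f) * (3 * (a * a * (b * b)))
    regroup₂ = solve 4 (λ t a b f → con 3 :* t :* ((a :* (b :* f)) :* (a :* (b :* f)))
                                 := t :* (f :* f) :* (con 3 :* (a :* a :* (b :* b)))) refl

    regroup₃ : ∀ t f g a b c s → t * (f * g) * (2 * (a * b * c * s)) ≡ 2 * t * (a * (b * (c * f)) * (s * g))
    regroup₃ = solve 7 (λ t f g a b c s → t :* (f :* g) :* (con 2 :* (a :* b :* c :* s))
                                       := con 2 :* t :* (a :* (b :* (c :* f)) :* (s :* g))) refl

  pair-weight : ∀ x k N → x * (k + k) ! ≡ N * (k ! * k !) → x * ((2 * k) C k) ≡ N
  pair-weight x k N hyp = *-cancelʳ-≡ _ _ (k ! * k !) {{k !* k !≢0}} (begin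
    x * B * (k ! * k !)   ≡⟨ *-assoc x B (k ! * k !) ⟩
    x * (B * (k ! * k !)) ≡⟨ cong (x *_) (central-binomial k) ⟩
    x * (k + k) !         ≡⟨ hyp ⟩
    N * (k ! * k !)       ∎)
    where
    open ≡-Reasoning
    B = (2 * k) C k

  triple-weight : ∀ x k N → x * (k + (k + k)) ! ≡ N * (k ! * (k + k) !) →
                  x * (((2 * k) C k) * 3 ^ k) ≤ 2 ^ k * N
  triple-weight x k N hyp = *-cancelʳ-≤ _ _ (F₃ * k !) {{(k + (k + k)) !* k !≢0}} (begin
    x * (B * 3 ^ k) * (F₃ * k !)            ≡⟨ regroup₁ x B (3 ^ k) F₃ (k !) ⟩
    x * F₃ * (B * k !) * 3 ^ k              ≡⟨ cong (λ y → y * (B * k !) * 3 ^ k) hyp ⟩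
    N * (k ! * F₂) * (B * k !) * 3 ^ k      ≡⟨ regroup₂ N (k !) F₂ B (3 ^ k) ⟩
    N * (3 ^ k * (F₂ * (B * (k ! * k !))))  ≡⟨ cong (λ y → N * (3 ^ k * (F₂ * y))) (central-binomial k) ⟩
    N * (3 ^ k * (F₂ * F₂))                 ≤⟨ *-monoʳ-≤ N (3^k*[2k]!²≤2^k*[3k]!*k! k) ⟩
    N * (2 ^ k * (F₃ * k !))                ≡⟨ x∙yz≈y∙xz N (2 ^ k) (F₃ * k !) ⟩
    2 ^ k * (N * (F₃ * k !))                ≡⟨ *-assoc (2 ^ k) N (F₃ * k !) ⟨
    2 ^ k * N * (F₃ * k !)                  ∎)
    where
    open ≤-Reasoning
    B  = (2 * k) C k
    F₂ = (k + k) !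
    F₃ = (k + (k + k)) !

    regroup₁ : ∀ x b t f g → x * (b * t) * (f * g) ≡ x * f * (b * g) * t
    regroup₁ = solve 5 (λ x b t f g → x :* (b :* t) :* (f :* g) := x :* f :* (b :* g) :* t) refl

    regroup₂ : ∀ n g f b t → n * (g * f) * (b * g) * t ≡ n * (t * (f * (b * (g * g))))
    regroup₂ = solve 5 (λ n g f b t → n :* (g :* f) :* (b :* g) :* t := n :* (t :* (f :* (b :* (g :* g))))) refl

  module _ {k : ℕ} {P Q : Subsetᶠ n} where

    ∑ₐ-pair : size P ≡ k → size Q ≡ k → Disjoint P Q → ∑ₐ n full ⟪ P ≺ Q ⟫ * ((2 * k) C k) ≡ n !
    ∑ₐ-pair ∣P∣≡k ∣Q∣≡k P∩Q=∅ =
      pair-weight (∑ₐ n full ⟪ P ≺ Q ⟫) k (n !)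
                  (∑ₐ-≺ n k k size-full ∣P∣≡k ∣Q∣≡k (λ _ _ → refl) (λ _ _ → refl) P∩Q=∅)

    ∑ₐ-triple : size P ≡ k → size Q ≡ k + k → Disjoint P Q →
                ∑ₐ n full ⟪ P ≺ Q ⟫ * (((2 * k) C k) * 3 ^ k) ≤ 2 ^ k * n !
    ∑ₐ-triple ∣P∣≡k ∣Q∣≡2k P∩Q=∅ =
      triple-weight (∑ₐ n full ⟪ P ≺ Q ⟫) k (n !)
                    (∑ₐ-≺ n k (k + k) size-full ∣P∣≡k ∣Q∣≡2k (λ _ _ → refl) (λ _ _ → refl) P∩Q=∅)

    ∑ₐ-triple′ : size P ≡ k + k → size Q ≡ k → Disjoint P Q →
                 ∑ₐ n full ⟪ P ≺ Q ⟫ * (((2 * k) C k) * 3 ^ k) ≤ 2 ^ k * n !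
    ∑ₐ-triple′ ∣P∣≡2k ∣Q∣≡k P∩Q=∅ = triple-weight (∑ₐ n full ⟪ P ≺ Q ⟫) k (n !) (begin
      ∑ₐ n full ⟪ P ≺ Q ⟫ * (k + (k + k)) ! ≡⟨ cong (λ m → ∑ₐ n full ⟪ P ≺ Q ⟫ * m !) (+-comm k (k + k)) ⟩
      ∑ₐ n full ⟪ P ≺ Q ⟫ * (k + k + k) !   ≡⟨ ∑ₐ-≺ n (k + k) k size-full ∣P∣≡2k ∣Q∣≡k (λ _ _ → refl) (λ _ _ → refl) P∩Q=∅ ⟩
      n ! * ((k + k) ! * k !)               ≡⟨ cong (n ! *_) (*-comm ((k + k) !) (k !)) ⟩
      n ! * (k ! * (k + k) !)               ∎)
      where open ≡-Reasoning

  disjoint-meeting⇒≤size : {Y : Fin d → Subsetᶠ n} {Z : Subsetᶠ n} →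
                           (∀ {a b} → a ≢ b → Disjoint (Y a) (Y b)) →
                           (∀ a → ∃ λ y → Y a y ≡ true × Z y ≡ true) → d ≤ size Z
  disjoint-meeting⇒≤size {d} {n} {Y} {Z} disjoint meets = begin
    d                                    ≡⟨ trans (∑-const d 1) (*-identityʳ d) ⟨
    ∑[ a < d ] 1                         ≤⟨ ∑-mono-≤ meets-once ⟩
    ∑[ a < d ] ∑[ y < n ] 𝟙 (Z y ∧ Y a y) ≡⟨ ∑-comm {d} {n} (λ a y → 𝟙 (Z y ∧ Y a y)) ⟩
    ∑[ y < n ] ∑[ a < d ] 𝟙 (Z y ∧ Y a y) ≤⟨ ∑-mono-≤ at-most-once ⟩
    size Z                               ∎
    where
    open ≤-Reasoning
    meets-once : ∀ a → 1 ≤ ∑[ y < n ] 𝟙 (Z y ∧ Y a y)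
    meets-once a with meets a
    ... | y , Yay , Zy = subst (λ b → 𝟙 b ≤ _) (cong₂ _∧_ Zy Yay) (term≤∑ (λ y → 𝟙 (Z y ∧ Y a y)) y)
    at-most-once : ∀ y → ∑[ a < d ] 𝟙 (Z y ∧ Y a y) ≤ 𝟙 (Z y)
    at-most-once y with Z y
    ... | false = ≤-reflexive (trans (∑-const d 0) (*-zeroʳ d))
    ... | true  = ∑≤1 (λ a → 𝟙 (Y a y)) (λ a → 𝟙≤1 (Y a y)) unique
      where
      𝟙>0⇒ : ∀ {b} → 0 < 𝟙 b → b ≡ true
      𝟙>0⇒ {true} _ = refl
      unique : ∀ a b → 0 < 𝟙 (Y a y) → 0 < 𝟙 (Y b y) → a ≡ b
      unique a b Yay Yby with a ≟ b
      ... | yes a≡b = a≡b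
      ... | no a≢b  = ⊥-elim (not-¬ (𝟙>0⇒ Yby) (disjoint a≢b y (𝟙>0⇒ Yay)))

  module DisjointFamily {d : ℕ} (X : Fin d → Subsetᶠ n)
                        (disjoint : ∀ {a b} → a ≢ b → Disjoint (X a) (X b))
                        (nonempty : ∀ a → Nonempty (X a)) where

    pairEvent : Fin d → Fin d → List (Fin n) → ℕ
    pairEvent a b π = ⟦ a ≢? b ⟧ * ⟪ X a ≺ X b ⟫ π

    pairEvents : List (Fin n) → ℕ
    pairEvents π = ∑[ a < d ] ∑[ b < d ] pairEvent a b π

    tripleEvent : Fin d → Fin d → Fin d → List (Fin n) → ℕ
    tripleEvent a b c π = ⟦ distinct₃? a b c ⟧ * (⟪ X a ≺ X b ∪ X c ⟫ π + ⟪ X a ∪ X b ≺ X c ⟫ π)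

    tripleEvents : List (Fin n) → ℕ
    tripleEvents π = ∑[ a < d ] ∑[ b < d ] ∑[ c < d ] tripleEvent a b c π

    module _ {π : List (Fin n)} where

      pairEvent≤pairEvents : ∀ a b → pairEvent a b π ≤ pairEvents π
      pairEvent≤pairEvents a b = ≤-trans (term≤∑ (λ b → pairEvent a b π) b)
                                         (term≤∑ (λ a → ∑[ b < d ] pairEvent a b π) a)

      tripleEvent≤tripleEvents : ∀ a b c → tripleEvent a b c π ≤ tripleEvents π
      tripleEvent≤tripleEvents a b c =
        ≤-trans (term≤∑ (λ c → tripleEvent a b c π) c)
          (≤-trans (term≤∑ (λ b → ∑[ c < d ] tripleEvent a b c π) b)
                   (term≤∑ (λ a → ∑[ b < d ] ∑[ c < d ] tripleEvent a b c π) a))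

      pairEvent>0⇒ : ∀ a b → 0 < pairEvent a b π → a ≢ b × X a ≺[ π ] X b
      pairEvent>0⇒ a b = ⟦⟧*⟦⟧>0⇒ (a ≢? b) (X a ≺?[ π ] X b)

      pairEvents>0⇒ : 0 < pairEvents π → ∃₂ λ a b → a ≢ b × X a ≺[ π ] X b
      pairEvents>0⇒ pairEvents>0 with ∑>0⇒∃>0 (λ a → ∑[ b < d ] pairEvent a b π) pairEvents>0
      ... | a , row>0 with ∑>0⇒∃>0 (λ b → pairEvent a b π) row>0
      ...   | b , ab>0 = a , b , pairEvent>0⇒ a b ab>0

      pairEvents≤d² : pairEvents π ≤ d * d
      pairEvents≤d² = begin
        pairEvents π          ≤⟨ ∑-mono-≤ (λ a → ∑-mono-≤ λ b → ⟦⟧*⟦⟧≤1 (a ≢? b) (X a ≺?[ π ] X b)) ⟩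
        ∑[ a < d ] ∑[ b < d ] 1 ≡⟨ sum-cong-≗ {d} (λ _ → trans (∑-const d 1) (*-identityʳ d)) ⟩
        ∑[ a < d ] d          ≡⟨ ∑-const d d ⟩
        d * d                 ∎
        where open ≤-Reasoning

      tripleEvents>0₁ : ∀ {a b c} → Distinct₃ a b c → X a ≺[ π ] (X b ∪ X c) → 0 < tripleEvents π
      tripleEvents>0₁ {a} {b} {c} abc a≺bc = begin-strict
        0                                           <⟨ s≤s z≤n ⟩
        1                                           ≡⟨ ⟦⟧*⟦⟧≡1 (distinct₃? a b c) (X a ≺?[ π ] (X b ∪ X c)) abc a≺bc ⟨
        ⟦ distinct₃? a b c ⟧ * ⟪ X a ≺ X b ∪ X c ⟫ π  ≤⟨ *-monoʳ-≤ ⟦ distinct₃? a b c ⟧ (m≤m+n _ _) ⟩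
        tripleEvent a b c π                         ≤⟨ tripleEvent≤tripleEvents a b c ⟩
        tripleEvents π                              ∎
        where open ≤-Reasoning

      tripleEvents>0₂ : ∀ {a b c} → Distinct₃ a b c → (X a ∪ X b) ≺[ π ] X c → 0 < tripleEvents π
      tripleEvents>0₂ {a} {b} {c} abc ab≺c = begin-strict
        0                                           <⟨ s≤s z≤n ⟩
        1                                           ≡⟨ ⟦⟧*⟦⟧≡1 (distinct₃? a b c) ((X a ∪ X b) ≺?[ π ] X c) abc ab≺c ⟨
        ⟦ distinct₃? a b c ⟧ * ⟪ X a ∪ X b ≺ X c ⟫ π  ≤⟨ *-monoʳ-≤ ⟦ distinct₃? a b c ⟧ (m≤n+m _ _) ⟩
        tripleEvent a b c π                         ≤⟨ tripleEvent≤tripleEvents a b c ⟩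
        tripleEvents π                              ∎
        where open ≤-Reasoning

      module _ (no-triple : tripleEvents π ≡ 0) where

        private
          ¬≺∪ : ∀ {a b c} → Distinct₃ a b c → ¬ X a ≺[ π ] (X b ∪ X c)
          ¬≺∪ abc a≺bc = <-irrefl (sym no-triple) (tripleEvents>0₁ abc a≺bc)

          ¬∪≺ : ∀ {a b c} → Distinct₃ a b c → ¬ (X a ∪ X b) ≺[ π ] X c
          ¬∪≺ abc ab≺c = <-irrefl (sym no-triple) (tripleEvents>0₂ abc ab≺c)

        -- Two different pairs either share an end, chain through a common set, or interleave
        -- (≺-interleave); each case yields a triple event.
        unique-pair : ∀ {a b c e} → a ≢ b → c ≢ e → X a ≺[ π ] X b → X c ≺[ π ] X e → a ≡ c × b ≡ e
        unique-pair {a} {b} {c} {e} a≢b c≢e a≺b c≺e with a ≟ c | b ≟ e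
        ... | yes a≡c  | yes b≡e = a≡c , b≡e
        ... | yes refl | no b≢e  = ⊥-elim (¬≺∪ (a≢b , c≢e , b≢e) (≺-∪ʳ a≺b c≺e))
        ... | no a≢c   | yes refl = ⊥-elim (¬∪≺ (a≢c , a≢b , c≢e) (≺-∪ˡ a≺b c≺e))
        ... | no a≢c   | no b≢e with b ≟ c | a ≟ e
        ...   | yes refl | yes refl = ⊥-elim (≺-asym (nonempty a) (nonempty b) a≺b c≺e)
        ...   | yes refl | no a≢e   = ⊥-elim (¬≺∪ (a≢b , a≢e , b≢e) (≺-∪ʳ a≺b (≺-trans (nonempty b) a≺b c≺e)))
        ...   | no b≢c   | yes refl = ⊥-elim (¬≺∪ (c≢e , ≢-sym b≢c , a≢b) (≺-∪ʳ c≺e (≺-trans (nonempty a) c≺e a≺b)))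
        ...   | no b≢c   | no a≢e with ≺-interleave a≺b c≺e
        ...     | inj₁ a≺e = ⊥-elim (¬≺∪ (a≢b , a≢e , b≢e) (≺-∪ʳ a≺b a≺e))
        ...     | inj₂ c≺b = ⊥-elim (¬≺∪ (c≢e , ≢-sym b≢c , ≢-sym b≢e) (≺-∪ʳ c≺e c≺b))

        pairEvents≤1 : pairEvents π ≤ 1
        pairEvents≤1 = ∑≤1 row row≤1 λ a c row-a>0 row-c>0 →
          let b , a≢b , a≺b = row>0⇒ a row-a>0
              e , c≢e , c≺e = row>0⇒ c row-c>0
          in proj₁ (unique-pair a≢b c≢e a≺b c≺e)
          where
          row : Fin d → ℕ
          row a = ∑[ b < d ] pairEvent a b π
          row>0⇒ : ∀ a → 0 < row a → ∃ λ b → a ≢ b × X a ≺[ π ] X b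
          row>0⇒ a row>0 with ∑>0⇒∃>0 (λ b → pairEvent a b π) row>0
          ... | b , ab>0 = b , pairEvent>0⇒ a b ab>0
          row≤1 : ∀ a → row a ≤ 1
          row≤1 a = ∑≤1 (λ b → pairEvent a b π) (λ b → ⟦⟧*⟦⟧≤1 (a ≢? b) (X a ≺?[ π ] X b)) λ b e ab>0 ae>0 →
            let a≢b , a≺b = pairEvent>0⇒ a b ab>0
                a≢e , a≺e = pairEvent>0⇒ a e ae>0
            in proj₂ (unique-pair a≢b a≢e a≺b a≺e)

      pairEvents≤⊓1+d²tripleEvents : pairEvents π ≤ pairEvents π ⊓ 1 + d * d * tripleEvents π
      pairEvents≤⊓1+d²tripleEvents with tripleEvents π in no-triple
      ... | zero  = ≤-trans (≤-reflexive (sym (m≤n⇒m⊓n≡m (pairEvents≤1 no-triple)))) (m≤m+n _ _)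
      ... | suc t = ≤-trans pairEvents≤d² (≤-trans (m≤m*n (d * d) (suc t)) (m≤n+m _ _))

      ⟪⟫≤pairEvents⊓1 : ∀ {a b} → a ≢ b → ⟪ X a ≺ X b ⟫ π ≤ pairEvents π ⊓ 1
      ⟪⟫≤pairEvents⊓1 {a} {b} a≢b = ⊓-glb
        (subst (_≤ pairEvents π) (trans (cong (_* _) (⟦⟧≡1 (a ≢? b) a≢b)) (*-identityˡ _)) (pairEvent≤pairEvents a b))
        (𝟙≤1 _)

    module _ {k : ℕ} (uniform : ∀ a → size (X a) ≡ k) where

      private
        B = (2 * k) C k
        W = B * 3 ^ k

      ∑ₐ-pairEvent : ∀ a b → ∑ₐ n full (pairEvent a b) * B ≡ ⟦ a ≢? b ⟧ * n !
      ∑ₐ-pairEvent a b = begin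
        ∑ₐ n full (pairEvent a b) * B              ≡⟨ cong (_* B) (∑ₐ-*ˡ n full ⟦ a ≢? b ⟧ ⟪ X a ≺ X b ⟫) ⟩
        ⟦ a ≢? b ⟧ * ∑ₐ n full ⟪ X a ≺ X b ⟫ * B   ≡⟨ *-assoc ⟦ a ≢? b ⟧ _ B ⟩
        ⟦ a ≢? b ⟧ * (∑ₐ n full ⟪ X a ≺ X b ⟫ * B) ≡⟨ ⟦⟧*-cong (a ≢? b) (λ a≢b →
                                                         ∑ₐ-pair (uniform a) (uniform b) (disjoint a≢b)) ⟩
        ⟦ a ≢? b ⟧ * n !                           ∎
        where open ≡-Reasoning

      ∑ₐ-pairEvents : ∑ₐ n full pairEvents * B ≡ d * (d ∸ 1) * n !
      ∑ₐ-pairEvents = begin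
        ∑ₐ n full pairEvents * B
          ≡⟨ cong (_* B) (trans (∑ₐ-∑ n full d _) (sum-cong-≗ {d} λ a → ∑ₐ-∑ n full d (pairEvent a))) ⟩
        (∑[ a < d ] ∑[ b < d ] ∑ₐ n full (pairEvent a b)) * B
          ≡⟨ trans (*-distribʳ-sum {d} B _) (sum-cong-≗ {d} λ a → *-distribʳ-sum {d} B _) ⟩
        ∑[ a < d ] ∑[ b < d ] (∑ₐ n full (pairEvent a b) * B)
          ≡⟨ sum-cong-≗ {d} (λ a → sum-cong-≗ {d} (∑ₐ-pairEvent a)) ⟩
        ∑[ a < d ] ∑[ b < d ] (⟦ a ≢? b ⟧ * n !)
          ≡⟨ sum-cong-≗ {d} (λ a → trans (sym (*-distribʳ-sum {d} (n !) λ b → ⟦ a ≢? b ⟧)) (cong (_* n !) (∑-≢ a))) ⟩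
        ∑[ a < d ] ((d ∸ 1) * n !)
          ≡⟨ trans (∑-const d _) (sym (*-assoc d (d ∸ 1) (n !))) ⟩
        d * (d ∸ 1) * n ! ∎
        where open ≡-Reasoning

      ∑ₐ-tripleEvent : ∀ a b c → ∑ₐ n full (tripleEvent a b c) * W ≤ 2 * (2 ^ k * n !)
      ∑ₐ-tripleEvent a b c = begin
        ∑ₐ n full (tripleEvent a b c) * W              ≡⟨ cong (_* W) (∑ₐ-*ˡ n full ⟦ distinct₃? a b c ⟧ _) ⟩
        ⟦ distinct₃? a b c ⟧ * ∑ₐ n full either * W    ≡⟨ *-assoc ⟦ distinct₃? a b c ⟧ _ W ⟩
        ⟦ distinct₃? a b c ⟧ * (∑ₐ n full either * W)  ≤⟨ ⟦⟧*-mono-≤ (distinct₃? a b c) both-orders ⟩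
        ⟦ distinct₃? a b c ⟧ * (2 * (2 ^ k * n !))     ≤⟨ ⟦⟧*-≤ (distinct₃? a b c) ⟩
        2 * (2 ^ k * n !)                              ∎
        where
        open ≤-Reasoning
        either : List (Fin n) → ℕ
        either π = ⟪ X a ≺ X b ∪ X c ⟫ π + ⟪ X a ∪ X b ≺ X c ⟫ π
        both-orders : Distinct₃ a b c → ∑ₐ n full either * W ≤ 2 * (2 ^ k * n !)
        both-orders (a≢b , a≢c , b≢c) = begin
          ∑ₐ n full either * W
            ≡⟨ cong (_* W) (∑ₐ-distrib-+ n full ⟪ X a ≺ X b ∪ X c ⟫ ⟪ X a ∪ X b ≺ X c ⟫) ⟩
          (∑ₐ n full ⟪ X a ≺ X b ∪ X c ⟫ + ∑ₐ n full ⟪ X a ∪ X b ≺ X c ⟫) * W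
            ≡⟨ *-distribʳ-+ W (∑ₐ n full ⟪ X a ≺ X b ∪ X c ⟫) _ ⟩
          ∑ₐ n full ⟪ X a ≺ X b ∪ X c ⟫ * W + ∑ₐ n full ⟪ X a ∪ X b ≺ X c ⟫ * W
            ≤⟨ +-mono-≤ (∑ₐ-triple (uniform a) ∣b∪c∣ (Disjoint-∪ʳ (disjoint a≢b) (disjoint a≢c)))
                        (∑ₐ-triple′ ∣a∪b∣ (uniform c) (Disjoint-∪ˡ (disjoint a≢c) (disjoint b≢c))) ⟩
          2 ^ k * n ! + 2 ^ k * n !
            ≡⟨ cong (2 ^ k * n ! +_) (+-identityʳ (2 ^ k * n !)) ⟨
          2 * (2 ^ k * n !) ∎
          where
          ∣b∪c∣ : size (X b ∪ X c) ≡ k + k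
          ∣b∪c∣ = trans (size-∪ (disjoint b≢c)) (cong₂ _+_ (uniform b) (uniform c))
          ∣a∪b∣ : size (X a ∪ X b) ≡ k + k
          ∣a∪b∣ = trans (size-∪ (disjoint a≢b)) (cong₂ _+_ (uniform a) (uniform b))

      ∑ₐ-tripleEvents : ∑ₐ n full tripleEvents * W ≤ d * (d * (d * (2 * (2 ^ k * n !))))
      ∑ₐ-tripleEvents = begin
        ∑ₐ n full tripleEvents * W
          ≡⟨ cong (_* W) (trans (∑ₐ-∑ n full d _) (sum-cong-≗ {d} λ a → trans (∑ₐ-∑ n full d _)
                                                   (sum-cong-≗ {d} λ b → ∑ₐ-∑ n full d (tripleEvent a b)))) ⟩
        (∑[ a < d ] ∑[ b < d ] ∑[ c < d ] ∑ₐ n full (tripleEvent a b c)) * W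
          ≡⟨ trans (*-distribʳ-sum {d} W _) (sum-cong-≗ {d} λ a → trans (*-distribʳ-sum {d} W _)
                                           (sum-cong-≗ {d} λ b → *-distribʳ-sum {d} W _)) ⟩
        ∑[ a < d ] ∑[ b < d ] ∑[ c < d ] (∑ₐ n full (tripleEvent a b c) * W)
          ≤⟨ ∑-mono-≤ (λ a → ∑-mono-≤ λ b → ∑-mono-≤ λ c → ∑ₐ-tripleEvent a b c) ⟩
        ∑[ a < d ] ∑[ b < d ] ∑[ c < d ] (2 * (2 ^ k * n !))
          ≡⟨ trans (sum-cong-≗ {d} λ a → trans (sum-cong-≗ {d} λ b → ∑-const d _) (∑-const d _)) (∑-const d _) ⟩
        d * (d * (d * (2 * (2 ^ k * n !)))) ∎
        where open ≤-Reasoning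

  Σ[<]≡∑ : ∀ t (f : Fin t → ℕ) → Σ[< t ] f ≡ ∑[ i < t ] f i
  Σ[<]≡∑ t f = trans (cong ListAction.sum (map-tabulate id f)) (sum-tabulate t f)
    where
    sum-tabulate : ∀ t (f : Fin t → ℕ) → ListAction.sum (tabulate f) ≡ ∑[ i < t ] f i
    sum-tabulate zero    f = refl
    sum-tabulate (suc t) f = cong (f zero +_) (sum-tabulate t (f ∘ suc))

  size-lookup : (p : Subset n) → size (lookup p) ≡ ∣ p ∣ˢ
  size-lookup []           = refl
  size-lookup (true  ∷ p) = cong suc (size-lookup p)
  size-lookup (false ∷ p) = size-lookup p

  module CrossIntersectingMatching {n k t : ℕ} {d : Fin t → ℕ} {A : (i : Fin t) → Fin (d i) → Subset n}
                                   (matching : IsCrossIntersectingMatching n k t d A) where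

    open IsCrossIntersectingMatching matching

    X : (i : Fin t) → Fin (d i) → Subsetᶠ n
    X i a = lookup (A i a)

    size-X : ∀ i a → size (X i a) ≡ k
    size-X i a = trans (size-lookup (A i a)) (uniform i a)

    X-disjoint : ∀ i {a b} → a ≢ b → Disjoint (X i a) (X i b)
    X-disjoint i {a} {b} a≢b y y∈Xa with X i b y in y∈Xb
    ... | false = refl
    ... | true  = ⊥-elim (disjoint i a b a≢b (y , x∈p∩q⁺ (lookup⇒[]= y (A i a) y∈Xa , lookup⇒[]= y (A i b) y∈Xb)))

    X-nonempty : ∀ i a → Nonempty (X i a)
    X-nonempty i a = size>0⇒Nonempty (X i a) (subst (0 <_) (sym (size-X i a)) (≤-trans (s≤s z≤n) k≥2))

    X-cross : ∀ {i j} → i ≢ j → ∀ a b → ∃ λ y → X i a y ≡ true × X j b y ≡ true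
    X-cross {i} {j} i≢j a b with cross i j i≢j a b
    ... | y , y∈Aa∩Ab with x∈p∩q⁻ (A i a) (A j b) y∈Aa∩Ab
    ...   | y∈Aa , y∈Ab = y , []=⇒lookup y∈Aa , []=⇒lookup y∈Ab

    module Family (i : Fin t) = DisjointFamily (X i) (X-disjoint i) (X-nonempty i)
    open Family using (pairEvents; tripleEvents)

    d≤k : ∀ i → d i ≤ k
    d≤k i with another t≥2 i
    ... | j , i≢j = subst (d i ≤_) (size-X j a₀) (disjoint-meeting⇒≤size (X-disjoint i) λ a → X-cross i≢j a a₀)
      where
      a₀ : Fin (d j)
      a₀ = proj₁ (two-distinct (d≥2 j))

    -- A point of A i a ∩ A j e and a point of A j c ∩ A i b would each have to come before the other.
    ≺-cross : ∀ {i j} → i ≢ j → ∀ {a b c e π} → X i a ≺[ π ] X i b → ¬ X j c ≺[ π ] X j e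
    ≺-cross i≢j {a} {b} {c} {e} a≺b c≺e with X-cross i≢j a e | X-cross (≢-sym i≢j) c b
    ... | y , y∈Xa , y∈Xe | z , z∈Xc , z∈Xb = <-asym (≺⇒< a≺b y z y∈Xa z∈Xb) (≺⇒< c≺e z y z∈Xc y∈Xe)

    at-most-one-family : ∀ π → ∑[ i < t ] (pairEvents i π ⊓ 1) ≤ 1
    at-most-one-family π = ∑≤1 (λ i → pairEvents i π ⊓ 1) (λ i → m⊓n≤n (pairEvents i π) 1) unique
      where
      unique : ∀ i j → 0 < pairEvents i π ⊓ 1 → 0 < pairEvents j π ⊓ 1 → i ≡ j
      unique i j i>0 j>0 with i ≟ j
      ... | yes i≡j = i≡j
      ... | no i≢j
        with Family.pairEvents>0⇒ i (<-≤-trans i>0 (m⊓n≤m _ 1)) | Family.pairEvents>0⇒ j (<-≤-trans j>0 (m⊓n≤m _ 1))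
      ...   | _ , _ , _ , a≺b | _ , _ , _ , c≺e = ⊥-elim (≺-cross i≢j a≺b c≺e)

    pairs triples : List (Fin n) → ℕ
    pairs   π = ∑[ i < t ] pairEvents i π
    triples π = ∑[ i < t ] tripleEvents i π

    pairs≤1+k²triples : ∀ π → pairs π ≤ 1 + k * k * triples π
    pairs≤1+k²triples π = begin
      ∑[ i < t ] pairEvents i π
        ≤⟨ ∑-mono-≤ (λ i → ≤-trans (Family.pairEvents≤⊓1+d²tripleEvents i)
                                  (+-monoʳ-≤ _ (*-monoˡ-≤ (tripleEvents i π) (*-mono-≤ (d≤k i) (d≤k i))))) ⟩
      ∑[ i < t ] (pairEvents i π ⊓ 1 + k * k * tripleEvents i π)
        ≡⟨ ∑-distrib-+ {t} (λ i → pairEvents i π ⊓ 1) _ ⟩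
      ∑[ i < t ] (pairEvents i π ⊓ 1) + ∑[ i < t ] (k * k * tripleEvents i π)
        ≤⟨ +-mono-≤ (at-most-one-family π) (≤-reflexive (sym (*-distribˡ-sum {t} (k * k) _))) ⟩
      1 + k * k * ∑[ i < t ] tripleEvents i π ∎
      where open ≤-Reasoning

    private
      B = (2 * k) C k
      M = n !

    -- The events "A i a₀ before A i a₁", one per family, are pairwise exclusive and each has weight M / B.
    t≤B : t ≤ B
    t≤B = *-cancelʳ-≤ t B M {{n !≢0}} (begin
      t * M                                                ≡⟨ ∑-const t M ⟨
      ∑[ i < t ] M                                         ≡⟨ sum-cong-≗ {t} first-pair-weight ⟨
      ∑[ i < t ] (∑ₐ n full (first-pair i) * B)            ≡⟨ *-distribʳ-sum {t} B _ ⟨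
      (∑[ i < t ] ∑ₐ n full (first-pair i)) * B            ≡⟨ cong (_* B) (∑ₐ-∑ n full t first-pair) ⟨
      ∑ₐ n full (λ π → ∑[ i < t ] first-pair i π) * B      ≤⟨ *-monoˡ-≤ B (∑ₐ-mono-≤ n full first-pairs≤1) ⟩
      ∑ₐ n full (λ _ → 1) * B                              ≡⟨ cong (_* B) (∑ₐ-1 n full size-full) ⟩
      M * B                                                ≡⟨ *-comm M B ⟩
      B * M                                                ∎)
      where
      open ≤-Reasoning
      first-pair : Fin t → List (Fin n) → ℕ
      first-pair i with two-distinct (d≥2 i)
      ... | a , b , _ = ⟪ X i a ≺ X i b ⟫
      first-pair-weight : ∀ i → ∑ₐ n full (first-pair i) * B ≡ M
      first-pair-weight i with two-distinct (d≥2 i)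
      ... | a , b , a≢b = ∑ₐ-pair (size-X i a) (size-X i b) (X-disjoint i a≢b)
      first-pair≤ : ∀ i π → first-pair i π ≤ pairEvents i π ⊓ 1
      first-pair≤ i π with two-distinct (d≥2 i)
      ... | a , b , a≢b = Family.⟪⟫≤pairEvents⊓1 i a≢b
      first-pairs≤1 : ∀ π → ∑[ i < t ] first-pair i π ≤ 1
      first-pairs≤1 π = ≤-trans (∑-mono-≤ λ i → first-pair≤ i π) (at-most-one-family π)

    ∑ₐ-pairs : ∑ₐ n full pairs * B ≡ ∑[ i < t ] (d i * (d i ∸ 1)) * M
    ∑ₐ-pairs = begin
      ∑ₐ n full pairs * B                         ≡⟨ cong (_* B) (∑ₐ-∑ n full t pairEvents) ⟩
      (∑[ i < t ] ∑ₐ n full (pairEvents i)) * B   ≡⟨ *-distribʳ-sum {t} B _ ⟩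
      ∑[ i < t ] (∑ₐ n full (pairEvents i) * B)   ≡⟨ sum-cong-≗ {t} (λ i → Family.∑ₐ-pairEvents i (size-X i)) ⟩
      ∑[ i < t ] (d i * (d i ∸ 1) * M)            ≡⟨ *-distribʳ-sum {t} M _ ⟨
      ∑[ i < t ] (d i * (d i ∸ 1)) * M            ∎
      where open ≡-Reasoning

    ∑ₐ-pairs≤ : ∑ₐ n full pairs ≤ M + k * k * ∑ₐ n full triples
    ∑ₐ-pairs≤ = begin
      ∑ₐ n full pairs                                         ≤⟨ ∑ₐ-mono-≤ n full pairs≤1+k²triples ⟩
      ∑ₐ n full (λ π → 1 + k * k * triples π)                 ≡⟨ ∑ₐ-distrib-+ n full (λ _ → 1) _ ⟩
      ∑ₐ n full (λ _ → 1) + ∑ₐ n full (λ π → k * k * triples π)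
        ≡⟨ cong₂ _+_ (∑ₐ-1 n full size-full) (∑ₐ-*ˡ n full (k * k) triples) ⟩
      M + k * k * ∑ₐ n full triples                           ∎
      where open ≤-Reasoning

    ∑ₐ-triples : ∑ₐ n full triples * (B * 3 ^ k) ≤ B * (k * (k * (k * (2 * (2 ^ k * M)))))
    ∑ₐ-triples = begin
      ∑ₐ n full triples * W                                 ≡⟨ cong (_* W) (∑ₐ-∑ n full t tripleEvents) ⟩
      (∑[ i < t ] ∑ₐ n full (tripleEvents i)) * W           ≡⟨ *-distribʳ-sum {t} W _ ⟩
      ∑[ i < t ] (∑ₐ n full (tripleEvents i) * W)            ≤⟨ ∑-mono-≤ (λ i → Family.∑ₐ-tripleEvents i (size-X i)) ⟩
      ∑[ i < t ] (d i * (d i * (d i * (2 * (2 ^ k * M)))))   ≤⟨ ∑-mono-≤ (λ i → *-mono-≤ (d≤k i) (*-mono-≤ (d≤k i)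
                                                                 (*-monoˡ-≤ (2 * (2 ^ k * M)) (d≤k i)))) ⟩
      ∑[ i < t ] (k * (k * (k * (2 * (2 ^ k * M)))))          ≡⟨ ∑-const t _ ⟩
      t * (k * (k * (k * (2 * (2 ^ k * M)))))                ≤⟨ *-monoˡ-≤ _ t≤B ⟩
      B * (k * (k * (k * (2 * (2 ^ k * M)))))                ∎
      where
      open ≤-Reasoning
      W = B * 3 ^ k

    pair-count-bound : Σ[< t ] (λ i → d i * (d i ∸ 1)) * 3 ^ k ≤ B * 3 ^ k + 2 * k ^ 5 * 2 ^ k * B
    pair-count-bound rewrite Σ[<]≡∑ t (λ i → d i * (d i ∸ 1)) = *-cancelʳ-≤ _ _ M {{n !≢0}} (begin
      D * 3 ^ k * M                                  ≡⟨ xy∙z≈xz∙y D (3 ^ k) M ⟩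
      D * M * 3 ^ k                                  ≡⟨ cong (_* 3 ^ k) ∑ₐ-pairs ⟨
      E * B * 3 ^ k                                  ≡⟨ *-assoc E B (3 ^ k) ⟩
      E * W                                          ≤⟨ *-monoˡ-≤ W ∑ₐ-pairs≤ ⟩
      (M + k * k * T) * W                            ≡⟨ *-distribʳ-+ W M (k * k * T) ⟩
      M * W + k * k * T * W                          ≡⟨ cong (M * W +_) (*-assoc (k * k) T W) ⟩
      M * W + k * k * (T * W)                        ≤⟨ +-monoʳ-≤ (M * W) (*-monoʳ-≤ (k * k) ∑ₐ-triples) ⟩
      M * W + k * k * (B * (k * (k * (k * (2 * (2 ^ k * M))))))
                                                     ≡⟨ collect B (3 ^ k) (2 ^ k) k M ⟩
      (B * 3 ^ k + 2 * k ^ 5 * 2 ^ k * B) * M        ∎)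
      where
      open ≤-Reasoning
      D = ∑[ i < t ] (d i * (d i ∸ 1))
      E = ∑ₐ n full pairs
      T = ∑ₐ n full triples
      W = B * 3 ^ k
      collect : ∀ b t₃ t₂ k m → m * (b * t₃) + k * k * (b * (k * (k * (k * (2 * (t₂ * m))))))
                               ≡ (b * t₃ + 2 * k ^ 5 * t₂ * b) * m
      collect = solve 5 (λ b t₃ t₂ k m → m :* (b :* t₃) :+ k :* k :* (b :* (k :* (k :* (k :* (con 2 :* (t₂ :* m))))))
                                       := (b :* t₃ :+ con 2 :* k :^ 5 :* t₂ :* b) :* m) refl

  ^-distribʳ-* : ∀ a b k → (a * b) ^ k ≡ a ^ k * b ^ k
  ^-distribʳ-* a b zero    = refl
  ^-distribʳ-* a b (suc k) = trans (cong (a * b *_) (^-distribʳ-* a b k)) (interchange a b (a ^ k) (b ^ k))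

  k*m^k≤m*[1+m]^k : ∀ m k → k * m ^ k ≤ m * suc m ^ k
  k*m^k≤m*[1+m]^k m k = ≤-trans (≤-trans (≤-reflexive (*-comm k (m ^ k))) (*-monoʳ-≤ (m ^ k) (m≤n+m k m)))
                                  (bernoulli k)
    where
    bernoulli : ∀ k → m ^ k * (m + k) ≤ m * suc m ^ k
    bernoulli zero    = ≤-reflexive (trans (*-identityˡ (m + 0)) (trans (+-identityʳ m) (sym (*-identityʳ m))))
    bernoulli (suc k) = begin
      m * m ^ k * (m + suc k)                ≤⟨ m≤m+n _ (m ^ k * k) ⟩
      m * m ^ k * (m + suc k) + m ^ k * k    ≡⟨ regroup m (m ^ k) k ⟩
      m ^ k * (m + k) * suc m                ≤⟨ *-monoˡ-≤ (suc m) (bernoulli k) ⟩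
      m * suc m ^ k * suc m                  ≡⟨ xy∙z≈x∙zy m (suc m ^ k) (suc m) ⟩
      m * suc m ^ suc k                      ∎
      where
      open ≤-Reasoning
      regroup : ∀ m x k → m * x * (m + suc k) + x * k ≡ x * (m + k) * suc m
      regroup = solve 3 (λ m x k → m :* x :* (m :+ (con 1 :+ k)) :+ x :* k := x :* (m :+ k) :* (con 1 :+ m)) refl

  2k⁵*2^k*[3*20⁵]^k≤2*20⁵*[2*21⁵]^k*3^k : ∀ k → 2 * k ^ 5 * 2 ^ k * (3 * 20 ^ 5) ^ k ≤ 2 * 20 ^ 5 * (2 * 21 ^ 5) ^ k * 3 ^ k
  2k⁵*2^k*[3*20⁵]^k≤2*20⁵*[2*21⁵]^k*3^k k = begin
    2 * k ^ 5 * 2 ^ k * (3 * 20 ^ 5) ^ k        ≡⟨ cong (2 * k ^ 5 * 2 ^ k *_) (split-power 3 20) ⟩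
    2 * k ^ 5 * 2 ^ k * (3 ^ k * (20 ^ k) ^ 5)  ≡⟨ regroup₁ k (2 ^ k) (3 ^ k) (20 ^ k) ⟩
    2 * 2 ^ k * 3 ^ k * (k * 20 ^ k) ^ 5        ≤⟨ *-monoʳ-≤ (2 * 2 ^ k * 3 ^ k) (^-monoˡ-≤ 5 (k*m^k≤m*[1+m]^k 20 k)) ⟩
    2 * 2 ^ k * 3 ^ k * (20 * 21 ^ k) ^ 5       ≡⟨ regroup₂ (2 ^ k) (3 ^ k) (21 ^ k) 20 ⟩
    2 * 20 ^ 5 * (2 ^ k * (21 ^ k) ^ 5) * 3 ^ k ≡⟨ cong (λ x → 2 * 20 ^ 5 * x * 3 ^ k) (split-power 2 21) ⟨
    2 * 20 ^ 5 * (2 * 21 ^ 5) ^ k * 3 ^ k       ∎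
    where
    open ≤-Reasoning
    split-power : ∀ a b → (a * b ^ 5) ^ k ≡ a ^ k * (b ^ k) ^ 5
    split-power a b = trans (^-distribʳ-* a (b ^ 5) k) (cong (a ^ k *_) (begin-equality
      (b ^ 5) ^ k ≡⟨ ^-*-assoc b 5 k ⟩
      b ^ (5 * k) ≡⟨ cong (b ^_) (*-comm 5 k) ⟩
      b ^ (k * 5) ≡⟨ ^-*-assoc b k 5 ⟨
      (b ^ k) ^ 5 ∎))
    regroup₁ : ∀ k t₂ t₃ u → 2 * k ^ 5 * t₂ * (t₃ * u ^ 5) ≡ 2 * t₂ * t₃ * (k * u) ^ 5
    regroup₁ = solve 4 (λ k t₂ t₃ u → con 2 :* k :^ 5 :* t₂ :* (t₃ :* u :^ 5) := con 2 :* t₂ :* t₃ :* (k :* u) :^ 5) refl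
    regroup₂ : ∀ t₂ t₃ v w → 2 * t₂ * t₃ * (w * v) ^ 5 ≡ 2 * w ^ 5 * (t₂ * v ^ 5) * t₃
    regroup₂ = solve 4 (λ t₂ t₃ v w → con 2 :* t₂ :* t₃ :* (w :* v) :^ 5 := con 2 :* w :^ 5 :* (t₂ :* v :^ 5) :* t₃) refl

open import Defs
open import Data.Nat using (ℕ; _≤_; _*_; _∸_)
open import Data.Nat.Combinatorics using (_C_)
open import Data.Fin using (Fin)
open import Data.Fin.Subset using (Subset)
open import Data.Product using (Σ; _×_)
open import Data.Rational using (ℚ; 0ℚ; 1ℚ; ∣_∣; _<_) renaming (_≤_ to _≤ℚ_; _+_ to _+ℚ_; _*_ to _*ℚ_)

open import Algebra.Bundles using (CommutativeRing)
open import Data.Integer using (+_)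
import Data.Integer as ℤ
import Data.Integer.Properties as ℤ
open import Data.Nat using (zero; suc; _+_; _^_; NonZero; z≤n)
open import Data.Nat.Coprimality using (1-coprimeTo)
import Data.Nat.Coprimality as Coprime
import Data.Nat.Properties as ℕ
open import Data.Product using (_,_)
open import Data.Rational using (toℚᵘ; _/_; *≤*)
open import Data.Rational.Properties
  using (normalize-coprime; normalize-pos; toℚᵘ-injective; toℚᵘ-homo-+; toℚᵘ-homo-*; *-cancelʳ-≤-pos;
         *-identityˡ; *-zeroˡ; *-assoc; +-*-commutativeRing; 0≤p⇒∣p∣≡p; _<?_)
open import Algebra.Properties.CommutativeSemigroup (CommutativeRing.*-commutativeSemigroup +-*-commutativeRing)
  using (interchange)
import Data.Rational.Unnormalised as ℚᵘ
import Data.Rational.Unnormalised.Properties as ℚᵘ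
open import Data.Rational.Solver using (module +-*-Solver)
open import Data.Unit using (tt)
open import Relation.Binary.PropositionalEquality
open import Relation.Nullary.Decidable using (toWitness)

open Combinatorics using (module CrossIntersectingMatching; 2k⁵*2^k*[3*20⁵]^k≤2*20⁵*[2*21⁵]^k*3^k)

toℚᵘ-ℕ→ℚ : ∀ n → toℚᵘ (ℕ→ℚ n) ≡ ℚᵘ.mkℚᵘ (+ n) 0
toℚᵘ-ℕ→ℚ n rewrite normalize-coprime (Coprime.sym (1-coprimeTo n)) = refl

ℕ→ℚ-homo-+ : ∀ m n → ℕ→ℚ (m + n) ≡ ℕ→ℚ m +ℚ ℕ→ℚ n
ℕ→ℚ-homo-+ m n = toℚᵘ-injective (ℚᵘ.≃-trans unnormalised (ℚᵘ.≃-sym (toℚᵘ-homo-+ (ℕ→ℚ m) (ℕ→ℚ n))))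
  where
  unnormalised : toℚᵘ (ℕ→ℚ (m + n)) ℚᵘ.≃ toℚᵘ (ℕ→ℚ m) ℚᵘ.+ toℚᵘ (ℕ→ℚ n)
  unnormalised rewrite toℚᵘ-ℕ→ℚ (m + n) | toℚᵘ-ℕ→ℚ m | toℚᵘ-ℕ→ℚ n =
    ℚᵘ.*≡* (cong (ℤ._* + 1) (trans (ℤ.pos-+ m n) (cong₂ ℤ._+_ (sym (ℤ.*-identityʳ (+ m))) (sym (ℤ.*-identityʳ (+ n))))))

ℕ→ℚ-homo-* : ∀ m n → ℕ→ℚ (m * n) ≡ ℕ→ℚ m *ℚ ℕ→ℚ n
ℕ→ℚ-homo-* m n = toℚᵘ-injective (ℚᵘ.≃-trans unnormalised (ℚᵘ.≃-sym (toℚᵘ-homo-* (ℕ→ℚ m) (ℕ→ℚ n))))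
  where
  unnormalised : toℚᵘ (ℕ→ℚ (m * n)) ℚᵘ.≃ toℚᵘ (ℕ→ℚ m) ℚᵘ.* toℚᵘ (ℕ→ℚ n)
  unnormalised rewrite toℚᵘ-ℕ→ℚ (m * n) | toℚᵘ-ℕ→ℚ m | toℚᵘ-ℕ→ℚ n = ℚᵘ.*≡* (cong (ℤ._* + 1) (ℤ.pos-* m n))

ℕ→ℚ-mono-≤ : ∀ {m n} → m ≤ n → ℕ→ℚ m ≤ℚ ℕ→ℚ n
ℕ→ℚ-mono-≤ {m} {n} m≤n
  rewrite normalize-coprime (Coprime.sym (1-coprimeTo m)) | normalize-coprime (Coprime.sym (1-coprimeTo n)) =
  *≤* (ℤ.*-monoʳ-≤-nonNeg (+ 1) (ℤ.+≤+ m≤n))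

≤-by-clearing : ∀ {x y : ℚ} m .{{_ : NonZero m}} u v →
                x *ℚ ℕ→ℚ m ≡ ℕ→ℚ u → y *ℚ ℕ→ℚ m ≡ ℕ→ℚ v → u ≤ v → x ≤ℚ y
≤-by-clearing m u v xm≡u ym≡v u≤v =
  *-cancelʳ-≤-pos (ℕ→ℚ m) {{normalize-pos m 1}} (subst₂ _≤ℚ_ (sym xm≡u) (sym ym≡v) (ℕ→ℚ-mono-≤ u≤v))

module _ {c : ℚ} {p q : ℕ} (c*q≡p : c *ℚ ℕ→ℚ q ≡ ℕ→ℚ p) where

  ^ℚ-ratio : ∀ k → c ^ℚ k *ℚ ℕ→ℚ (q ^ k) ≡ ℕ→ℚ (p ^ k)
  ^ℚ-ratio zero    = *-identityˡ 1ℚ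
  ^ℚ-ratio (suc k) = begin
    c *ℚ c ^ℚ k *ℚ ℕ→ℚ (q * q ^ k)           ≡⟨ cong (c *ℚ c ^ℚ k *ℚ_) (ℕ→ℚ-homo-* q (q ^ k)) ⟩
    c *ℚ c ^ℚ k *ℚ (ℕ→ℚ q *ℚ ℕ→ℚ (q ^ k))    ≡⟨ interchange c (c ^ℚ k) (ℕ→ℚ q) (ℕ→ℚ (q ^ k)) ⟩
    c *ℚ ℕ→ℚ q *ℚ (c ^ℚ k *ℚ ℕ→ℚ (q ^ k))    ≡⟨ cong₂ _*ℚ_ c*q≡p (^ℚ-ratio k) ⟩
    ℕ→ℚ p *ℚ ℕ→ℚ (p ^ k)                     ≡⟨ ℕ→ℚ-homo-* p (p ^ k) ⟨
    ℕ→ℚ (p * p ^ k)                          ∎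
    where open ≡-Reasoning

  scaled-power : ∀ a k → ℕ→ℚ a *ℚ c ^ℚ k *ℚ ℕ→ℚ (q ^ k) ≡ ℕ→ℚ (a * p ^ k)
  scaled-power a k = begin
    ℕ→ℚ a *ℚ c ^ℚ k *ℚ ℕ→ℚ (q ^ k)     ≡⟨ *-assoc (ℕ→ℚ a) (c ^ℚ k) (ℕ→ℚ (q ^ k)) ⟩
    ℕ→ℚ a *ℚ (c ^ℚ k *ℚ ℕ→ℚ (q ^ k))   ≡⟨ cong (ℕ→ℚ a *ℚ_) (^ℚ-ratio k) ⟩
    ℕ→ℚ a *ℚ ℕ→ℚ (p ^ k)               ≡⟨ ℕ→ℚ-homo-* a (p ^ k) ⟨
    ℕ→ℚ (a * p ^ k)                    ∎
    where open ≡-Reasoning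

  scaled-power-* : ∀ a k m → ℕ→ℚ a *ℚ c ^ℚ k *ℚ ℕ→ℚ (q ^ k * m) ≡ ℕ→ℚ (a * p ^ k * m)
  scaled-power-* a k m = begin
    ℕ→ℚ a *ℚ c ^ℚ k *ℚ ℕ→ℚ (q ^ k * m)           ≡⟨ cong (ℕ→ℚ a *ℚ c ^ℚ k *ℚ_) (ℕ→ℚ-homo-* (q ^ k) m) ⟩
    ℕ→ℚ a *ℚ c ^ℚ k *ℚ (ℕ→ℚ (q ^ k) *ℚ ℕ→ℚ m)   ≡⟨ *-assoc (ℕ→ℚ a *ℚ c ^ℚ k) (ℕ→ℚ (q ^ k)) (ℕ→ℚ m) ⟨
    ℕ→ℚ a *ℚ c ^ℚ k *ℚ ℕ→ℚ (q ^ k) *ℚ ℕ→ℚ m     ≡⟨ cong (_*ℚ ℕ→ℚ m) (scaled-power a k) ⟩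
    ℕ→ℚ (a * p ^ k) *ℚ ℕ→ℚ m                     ≡⟨ ℕ→ℚ-homo-* (a * p ^ k) m ⟨
    ℕ→ℚ (a * p ^ k * m)                          ∎
    where open ≡-Reasoning

  module _ .{{_ : NonZero q}} where

    scaled-power-nonNeg : ∀ a k → 0ℚ ≤ℚ ℕ→ℚ a *ℚ c ^ℚ k
    scaled-power-nonNeg a k =
      ≤-by-clearing (q ^ k) {{ℕ.m^n≢0 q k}} 0 (a * p ^ k) (*-zeroˡ (ℕ→ℚ (q ^ k))) (scaled-power a k) z≤n

    ≤-1+scaled-power : ∀ a k {D B} → D * q ^ k ≤ B * q ^ k + a * p ^ k * B →
                       ℕ→ℚ D ≤ℚ (1ℚ +ℚ ℕ→ℚ a *ℚ c ^ℚ k) *ℚ ℕ→ℚ B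
    ≤-1+scaled-power a k {D} {B} =
      ≤-by-clearing (q ^ k) {{ℕ.m^n≢0 q k}} _ _ (sym (ℕ→ℚ-homo-* D (q ^ k))) (begin
        (1ℚ +ℚ ℕ→ℚ a *ℚ c ^ℚ k) *ℚ ℕ→ℚ B *ℚ ℕ→ℚ (q ^ k)
          ≡⟨ expand (ℕ→ℚ a *ℚ c ^ℚ k) (ℕ→ℚ B) (ℕ→ℚ (q ^ k)) ⟩
        ℕ→ℚ B *ℚ ℕ→ℚ (q ^ k) +ℚ ℕ→ℚ a *ℚ c ^ℚ k *ℚ ℕ→ℚ (q ^ k) *ℚ ℕ→ℚ B
          ≡⟨ cong₂ _+ℚ_ (ℕ→ℚ-homo-* B (q ^ k)) (cong (_*ℚ ℕ→ℚ B) (sym (scaled-power a k))) ⟨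
        ℕ→ℚ (B * q ^ k) +ℚ ℕ→ℚ (a * p ^ k) *ℚ ℕ→ℚ B
          ≡⟨ cong (ℕ→ℚ (B * q ^ k) +ℚ_) (ℕ→ℚ-homo-* (a * p ^ k) B) ⟨
        ℕ→ℚ (B * q ^ k) +ℚ ℕ→ℚ (a * p ^ k * B)
          ≡⟨ ℕ→ℚ-homo-+ (B * q ^ k) (a * p ^ k * B) ⟨
        ℕ→ℚ (B * q ^ k + a * p ^ k * B) ∎)
      where
      open ≡-Reasoning
      open +-*-Solver
      expand : ∀ g b y → (1ℚ +ℚ g) *ℚ b *ℚ y ≡ b *ℚ y +ℚ g *ℚ y *ℚ b
      expand = solve 3 (λ g b y → (con 1ℚ :+ g) :* b :* y := b :* y :+ g :* y :* b) refl

scaled-power-mono : ∀ {c c′ : ℚ} {p q p′ q′ : ℕ} .{{_ : NonZero q}} .{{_ : NonZero q′}} →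
                    c *ℚ ℕ→ℚ q ≡ ℕ→ℚ p → c′ *ℚ ℕ→ℚ q′ ≡ ℕ→ℚ p′ →
                    ∀ a a′ k → a * p ^ k * q′ ^ k ≤ a′ * p′ ^ k * q ^ k →
                    ℕ→ℚ a *ℚ c ^ℚ k ≤ℚ ℕ→ℚ a′ *ℚ c′ ^ℚ k
scaled-power-mono {c} {c′} {p} {q} {p′} {q′} c*q≡p c′*q′≡p′ a a′ k =
  ≤-by-clearing (q ^ k * q′ ^ k) {{ℕ.m*n≢0 (q ^ k) (q′ ^ k) {{ℕ.m^n≢0 q k}} {{ℕ.m^n≢0 q′ k}}}} _ _
    (scaled-power-* {c} {p} {q} c*q≡p a k (q′ ^ k))
    (trans (cong (λ m → ℕ→ℚ a′ *ℚ c′ ^ℚ k *ℚ ℕ→ℚ m) (ℕ.*-comm (q ^ k) (q′ ^ k)))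
           (scaled-power-* {c′} {p′} {q′} c′*q′≡p′ a′ k (q ^ k)))

γ : ℕ → ℚ
γ k = ℕ→ℚ (2 * k ^ 5) *ℚ (+ 2 / 3) ^ℚ k

-- c = (2/3)(21/20)⁵ and the constant 2·20⁵ come from k·20ᵏ ≤ 20·21ᵏ, i.e. k⁵ ≤ 20⁵ (21/20)⁵ᵏ.
c : ℚ
c = + (2 * 21 ^ 5) / (3 * 20 ^ 5)

2/3*3≡2 : (+ 2 / 3) *ℚ ℕ→ℚ 3 ≡ ℕ→ℚ 2
2/3*3≡2 = refl

c*[3*20⁵]≡2*21⁵ : c *ℚ ℕ→ℚ (3 * 20 ^ 5) ≡ ℕ→ℚ (2 * 21 ^ 5)
c*[3*20⁵]≡2*21⁵ = refl

0<c : 0ℚ < c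
0<c = toWitness {a? = 0ℚ <? c} tt

c<1 : c < 1ℚ
c<1 = toWitness {a? = c <? 1ℚ} tt

∣γ∣≤C*cᵏ : ∀ k → ∣ γ k ∣ ≤ℚ ℕ→ℚ (2 * 20 ^ 5) *ℚ c ^ℚ k
∣γ∣≤C*cᵏ k = subst (_≤ℚ ℕ→ℚ (2 * 20 ^ 5) *ℚ c ^ℚ k) (sym (0≤p⇒∣p∣≡p γ≥0))
  (scaled-power-mono {+ 2 / 3} {c} {2} {3} {2 * 21 ^ 5} {3 * 20 ^ 5} 2/3*3≡2 c*[3*20⁵]≡2*21⁵
                     (2 * k ^ 5) (2 * 20 ^ 5) k (2k⁵*2^k*[3*20⁵]^k≤2*20⁵*[2*21⁵]^k*3^k k))
  where
  γ≥0 : 0ℚ ≤ℚ γ k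
  γ≥0 = scaled-power-nonNeg {+ 2 / 3} {2} {3} 2/3*3≡2 (2 * k ^ 5) k

lemma2p1 : Σ (ℕ → ℚ) λ γ →
    (Σ ℚ λ C → Σ ℚ λ c → (0ℚ < c) × (c < 1ℚ) ×
      (∀ (k : ℕ) → 2 ≤ k → ∣ γ k ∣ ≤ℚ C *ℚ (c ^ℚ k)))
    × (∀ (n k t : ℕ) (d : Fin t → ℕ) (A : (i : Fin t) → Fin (d i) → Subset n) →
         IsCrossIntersectingMatching n k t d A →
         ℕ→ℚ (Σ[< t ] (λ i → d i * (d i ∸ 1)))
           ≤ℚ (1ℚ +ℚ γ k) *ℚ ℕ→ℚ ((2 * k) C k))
lemma2p1 = γ , (ℕ→ℚ (2 * 20 ^ 5) , c , 0<c , c<1 , λ k _ → ∣γ∣≤C*cᵏ k) , λ n k t d A matching →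
  ≤-1+scaled-power {+ 2 / 3} {2} {3} 2/3*3≡2 (2 * k ^ 5) k {Σ[< t ] (λ i → d i * (d i ∸ 1))} {(2 * k) C k}
                   (CrossIntersectingMatching.pair-count-bound matching)
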